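{- Let $m,p\in\mathbb{N}$ and let $a_n=\lfloor n\phi_{mp}/p\rfloor$, $b_n=\lfloor n(\phi_{mp}+mp)/p\rfloor$ ($n\in\mathbb{N}_0$), where $\phi_k=\frac{2-k+\sqrt{k^2+4}}{2}$. Each of the following three recursive definitions of sequences $(x_n)_{n\in\mathbb{N}_0}$, $(y_n)_{n\in\mathbb{N}_0}$ yields $x_n=a_n$ and $y_n=b_n$ for all $n\in\mathbb{N}_0$ (in particular the three definitions are equivalent): (i) For $n\ge0$: $x_n=\mathrm{mex}^p\,\xi_n$, where $\xi_n=(\xi_n^i)_{i\in\mathbb{N}_0}$ with $\xi_n^i=\#\{j: 0\le j<n,\ i=x_j\text{ or } i=y_j\}$, and $y_n=x_n+mn$. (ii) For $n\ge0$: $x_n=\mathrm{mex}\{\nu_i^n,\mu_i^n\mid 0\le i<n\}$, where $\nu_i^n=x_i$ if $n\equiv i\pmod p$ and $\nu_i^n=\infty$ otherwise, $\mu_i^n=y_i$ if $n\equiv -i\pmod p$ and $\mu_i^n=\infty$ otherwise; and $y_n=x_n+mn$. (iii) For $n\ge0$: $x_{pn}=\mathrm{mex}\{x_{pi},y_{pi}\mid 0\le i<n\}$, $y_{pn}=x_{pn}+mpn$, and for each integer $0<l<p$, $x_{pn+l}=\mathrm{mex}\{x_{pi+l},y_{p(i+1)-l}\mid 0\le i<n\}$, $y_{pn+l}=x_{pn+l}+m(pn+l)$.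
   Context: $\mathbb{N}=\{1,2,\dots\}$, $\mathbb{N}_0=\{0,1,2,\dots\}$. For a set $X$ (possibly containing the symbol $\infty$), $\mathrm{mex}\,X$ is the least non-negative integer not in $X$; $\mathrm{mex}\,\emptyset=0$. For a sequence $\xi=(\xi^i)_{i\in\mathbb{N}_0}$ of non-negative integers (counting multiplicities of a multiset) and $p\in\mathbb{N}$, $\mathrm{mex}^p\,\xi$ is the least $i\in\mathbb{N}_0$ with $\xi^i<p$. -}

module Defs where

open import Data.Nat as ℕ using (ℕ; zero; suc; _+_; _*_; _∸_; _≡ᵇ_)
open import Data.Bool using (Bool; true; false; _∨_; if_then_else_)
open import Data.Integer as ℤ using (ℤ; +_)
open import Data.Integer.Divisibility as ℤD using ()
open import Data.Product using (_×_; ∃-syntax)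
open import Data.Sum using (_⊎_)
open import Relation.Nullary using (¬_)
open import Relation.Binary.PropositionalEquality using (_≡_)

-- mex of a subset of ℕ ∪ {∞}, given by its natural-number members P
-- (the symbol ∞ is never a candidate value, so it is simply omitted).
-- "v = mex P" : v ∉ P and every w < v lies in P.
IsMex : (ℕ → Set) → ℕ → Set
IsMex P v = ¬ P v × (∀ w → w ℕ.< v → P w)

IsMexP : ℕ → (ℕ → ℕ) → ℕ → Set
IsMexP p ξ v = ξ v ℕ.< p × (∀ w → w ℕ.< v → p ℕ.≤ ξ w)

count : (ℕ → ℕ) → (ℕ → ℕ) → ℕ → ℕ → ℕ
count x y zero    i = 0
count x y (suc n) i =
  count x y n i + (if (x n ≡ᵇ i) ∨ (y n ≡ᵇ i) then 1 else 0)

_≡_[mod_] : ℤ → ℤ → ℕ → Set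
a ≡ b [mod p ] = (+ p) ℤD.∣ (a ℤ.- b)

-- Floors of quadratic irrationals, without reals.
-- LeMulSqrt t s D  means  t ≤ s·√D  (t ∈ ℤ, s, D ∈ ℕ).
LeMulSqrt : ℤ → ℕ → ℕ → Set
LeMulSqrt t s D = (t ℤ.< + 0) ⊎ (t ℤ.* t ℤ.≤ + (s * s * D))

-- IsFloorQ c q D n a  means  a = ⌊ n (c + √D) / q ⌋   (q > 0), i.e.
--   q·a ≤ n c + n √D  <  q·(a+1).
IsFloorQ : ℤ → ℕ → ℕ → ℕ → ℕ → Set
IsFloorQ c q D n a =
  LeMulSqrt (+ (q * a) ℤ.- (+ n) ℤ.* c) n D ×
  ¬ LeMulSqrt (+ (q * suc a) ℤ.- (+ n) ℤ.* c) n D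

-- With k = m p and φ_k = (2 - k + √(k²+4))/2:
--   a_n = ⌊ n φ_k / p ⌋       = ⌊ n ((2 - k) + √(k²+4)) / (2p) ⌋
--   b_n = ⌊ n (φ_k + k) / p ⌋ = ⌊ n ((2 + k) + √(k²+4)) / (2p) ⌋
IsA : ℕ → ℕ → ℕ → ℕ → Set
IsA m p n a = IsFloorQ (+ 2 ℤ.- + (m * p)) (2 * p) (m * p * (m * p) + 4) n a

IsB : ℕ → ℕ → ℕ → ℕ → Set
IsB m p n b = IsFloorQ (+ 2 ℤ.+ + (m * p)) (2 * p) (m * p * (m * p) + 4) n b

DefI : ℕ → ℕ → (ℕ → ℕ) → (ℕ → ℕ) → Set
DefI m p x y = ∀ n → IsMexP p (count x y n) (x n) × y n ≡ x n + m * n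

MexSetII : ℕ → (ℕ → ℕ) → (ℕ → ℕ) → ℕ → ℕ → Set
MexSetII p x y n w =
  ∃[ i ] (i ℕ.< n ×
    (((+ n) ≡ (+ i) [mod p ] × w ≡ x i) ⊎
     ((+ n) ≡ ℤ.- (+ i) [mod p ] × w ≡ y i)))

DefII : ℕ → ℕ → (ℕ → ℕ) → (ℕ → ℕ) → Set
DefII m p x y = ∀ n → IsMex (MexSetII p x y n) (x n) × y n ≡ x n + m * n

MexSet0 : ℕ → (ℕ → ℕ) → (ℕ → ℕ) → ℕ → ℕ → Set
MexSet0 p x y n w = ∃[ i ] (i ℕ.< n × (w ≡ x (p * i) ⊎ w ≡ y (p * i)))

MexSetL : ℕ → (ℕ → ℕ) → (ℕ → ℕ) → ℕ → ℕ → ℕ → Set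
MexSetL p x y l n w =
  ∃[ i ] (i ℕ.< n × (w ≡ x (p * i + l) ⊎ w ≡ y (p * suc i ∸ l)))

DefIII : ℕ → ℕ → (ℕ → ℕ) → (ℕ → ℕ) → Set
DefIII m p x y =
  (∀ n → IsMex (MexSet0 p x y n) (x (p * n)) ×
         y (p * n) ≡ x (p * n) + m * (p * n)) ×
  (∀ n l → 0 ℕ.< l → l ℕ.< p →
         IsMex (MexSetL p x y l n) (x (p * n + l)) ×
         y (p * n + l) ≡ x (p * n + l) + m * (p * n + l))

module Submission where

-- BeattyPair describes "v ≤ a_j" and "v ≤ b_i" by inequalities linear in j and i,
-- and proves monotonicity, a growth bound, and the reflection
-- v ≤ b_i ⟺ ¬ (v ≤ a_{pv-i}); FloorForms matches these forms with the floors of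
-- the statement and gives the shift b_j = a_j + m j.  Thresholds introduces thrA v,
-- the number of j with a_j < v (and thrB), and derives from the reflection the
-- complementarity thrA v + thrB v = p v + 1: every value is taken exactly p times
-- by a and b together.
--
-- Each of the three definitions is then shown to produce x_n = a_n by strong
-- induction (FloorInduction): assuming x_i = a_i for i < n, the value a_n has the
-- defining mex-property at n, and that property determines x_n.

import Data.Nat
import Data.Integer

-- Every inequality below is proved by a
-- certificate: the gap b - a is rewritten (by the ring solver) into a
-- polynomial expression in quantities already known to be non-negative.
module IntegerSigns where
  open import Data.Nat using (z≤n)
  open import Data.Integer
  open import Data.Integer.Properties
  open import Data.Integer.Tactic.RingSolver using (solve-∀)
  open import Data.Empty using (⊥-elim)
  open import Relation.Binary.PropositionalEquality
  open import Relation.Nullary using (¬_; yes; no)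

  NonNeg Pos : ℤ → Set
  NonNeg x = + 0 ≤ x
  Pos    x = + 0 < x

  nonNeg-+ : ∀ {x y} → NonNeg x → NonNeg y → NonNeg (x + y)
  nonNeg-+ = +-mono-≤

  nonNeg-* : ∀ {x y} → NonNeg x → NonNeg y → NonNeg (x * y)
  nonNeg-* {+ a} {+ b} _ _ = subst NonNeg (pos-* a b) (+≤+ z≤n)

  nonNeg-square : ∀ x → NonNeg (x * x)
  nonNeg-square (+ a)    = nonNeg-* {+ a} (+≤+ z≤n) (+≤+ z≤n)
  nonNeg-square -[1+ a ] = +≤+ z≤n

  nonNeg-ℕ : ∀ n → NonNeg (+ n)
  nonNeg-ℕ n = +≤+ z≤n

  pos⇒nonNeg : ∀ {x} → Pos x → NonNeg x
  pos⇒nonNeg = <⇒≤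

  ≤-by : ∀ {a b} x → NonNeg x → x ≡ b - a → a ≤ b
  ≤-by x x≥0 e = 0≤i-j⇒j≤i (subst NonNeg e x≥0)

  <-by : ∀ {a b} x → NonNeg x → x ≡ b - a - + 1 → a < b
  <-by {a} {b} x x≥0 e =
    suc[i]≤j⇒i<j (≤-by x x≥0 (trans e (shift a b)))
    where shift : ∀ a b → b - a - + 1 ≡ b - (+ 1 + a)
          shift = solve-∀

  ≤-gap : ∀ {a b} → a ≤ b → NonNeg (b - a)
  ≤-gap = i≤j⇒0≤j-i

  <-gap : ∀ {a b} → a < b → NonNeg (b - a - + 1)
  <-gap {a} {b} a<b = subst NonNeg (shift a b) (≤-gap (i<j⇒suc[i]≤j a<b))
    where shift : ∀ a b → b - (+ 1 + a) ≡ b - a - + 1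
          shift = solve-∀

  ¬nonNeg-1 : ¬ NonNeg (- + 1)
  ¬nonNeg-1 ()

  pos-*-pos : ∀ {x y} → Pos x → Pos y → Pos (x * y)
  pos-*-pos {x} {y} x>0 y>0 =
    <-by _ (nonNeg-+ (nonNeg-+ (nonNeg-* (<-gap x>0) (<-gap y>0)) (<-gap x>0)) (<-gap y>0)) (cert x y)
    where cert : ∀ x y → (x - + 0 - + 1) * (y - + 0 - + 1) + (x - + 0 - + 1) + (y - + 0 - + 1)
                         ≡ x * y - + 0 - + 1
          cert = solve-∀

  square-≤⇒≤ : ∀ {x y} → NonNeg x → NonNeg y → x * x ≤ y * y → x ≤ y
  square-≤⇒≤ {x} {y} x≥0 y≥0 x²≤y² with x ≤? y
  ... | yes x≤y = x≤y
  ... | no x≰y = ⊥-elim (≤⇒≯ x²≤y² (<-by _ y²<x² (cert x y)))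
    where
    y<x = <-gap (≰⇒> x≰y)
    y²<x² = nonNeg-+ (nonNeg-+ (nonNeg-* y<x (nonNeg-+ x≥0 y≥0)) y<x) (nonNeg-+ y≥0 y≥0)
    cert : ∀ x y → (x - y - + 1) * (x + y) + (x - y - + 1) + (y + y) ≡ x * x - y * y - + 1
    cert = solve-∀

  square-<⇒< : ∀ {x y} → NonNeg y → x * x < y * y → x < y
  square-<⇒< {x} {y} y≥0 x²<y² with x <? y
  ... | yes x<y = x<y
  ... | no x≮y = ⊥-elim (<⇒≱ x²<y² (≤-by _ (nonNeg-+ (nonNeg-square (x - y)) (nonNeg-* (nonNeg-+ y≥0 y≥0) y≤x)) (cert x y)))
    where
    y≤x = ≤-gap (≮⇒≥ x≮y)
    cert : ∀ x y → (x - y) * (x - y) + (y + y) * (x - y) ≡ x * x - y * y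
    cert = solve-∀

  pos-cancelˡ : ∀ {a g} → NonNeg a → Pos (a * g) → Pos g
  pos-cancelˡ {a} {g} a≥0 ag>0 with + 0 <? g
  ... | yes g>0 = g>0
  ... | no g≯0 = ⊥-elim (<⇒≱ ag>0 (≤-by _ (nonNeg-* a≥0 (≤-gap (≮⇒≥ g≯0))) (cert a g)))
    where cert : ∀ a g → a * (+ 0 - g) ≡ + 0 - a * g
          cert = solve-∀

  nonNeg-cancelˡ : ∀ {a g} → Pos a → NonNeg (a * g) → NonNeg g
  nonNeg-cancelˡ {a} {g} a>0 ag≥0 with + 0 ≤? g
  ... | yes g≥0 = g≥0
  ... | no g≱0 = ⊥-elim (≤⇒≯ ag≥0 (<-by _ (nonNeg-+ (nonNeg-+ (nonNeg-* A G) A) G) (cert a g)))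
    where
    A = <-gap a>0
    G = <-gap (≰⇒> g≱0)
    cert : ∀ a g → (a - + 0 - + 1) * (+ 0 - g - + 1) + (a - + 0 - + 1) + (+ 0 - g - + 1)
                   ≡ + 0 - a * g - + 1
    cert = solve-∀

  *-monoˡ-<-Pos : ∀ {a x y} → Pos a → x < y → a * x < a * y
  *-monoˡ-<-Pos {a} {x} {y} a>0 x<y =
    <-by _ (nonNeg-+ (nonNeg-* (<-gap a>0) (<-gap x<y)) (nonNeg-+ (<-gap a>0) (<-gap x<y))) (cert a x y)
    where cert : ∀ a x y → (a - + 0 - + 1) * (y - x - + 1) + ((a - + 0 - + 1) + (y - x - + 1))
                           ≡ a * y - a * x - + 1
          cert = solve-∀

-- Comparisons of a rational c/d (d ≥ 0) with √D, phrased without reals: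
-- for c ≥ 0, "c ≤ d√D" means c² ≤ d²D, and every negative c lies below d√D.
module SqrtComparison (D : Data.Integer.ℤ) (D≥0 : IntegerSigns.NonNeg D) where
  open import Data.Integer
  open import Data.Integer.Properties
  open import Data.Integer.Tactic.RingSolver using (solve-∀)
  open import Relation.Binary.PropositionalEquality
  open import Data.Sum using (_⊎_; inj₁; inj₂)
  open import Data.Empty using (⊥-elim)
  open import Relation.Nullary using (¬_; yes; no)
  open IntegerSigns

  data LeSqrt (c d : ℤ) : Set where
    le-neg : c < + 0 → LeSqrt c d
    le-sq  : c * c ≤ d * d * D → LeSqrt c d
  data LtSqrt (c d : ℤ) : Set where
    lt-neg : c < + 0 → LtSqrt c d
    lt-sq  : c * c < d * d * D → LtSqrt c d
  data GeSqrt (c d : ℤ) : Set where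
    ge-sq : NonNeg c → d * d * D ≤ c * c → GeSqrt c d
  data GtSqrt (c d : ℤ) : Set where
    gt-sq : NonNeg c → d * d * D < c * c → GtSqrt c d

  le-or-gt : ∀ c d → LeSqrt c d ⊎ GtSqrt c d
  le-or-gt c d with c <? + 0
  ... | yes c<0 = inj₁ (le-neg c<0)
  ... | no c≮0 with c * c ≤? d * d * D
  ...   | yes h = inj₁ (le-sq h)
  ...   | no h  = inj₂ (gt-sq (≮⇒≥ c≮0) (≰⇒> h))

  ge-or-lt : ∀ c d → GeSqrt c d ⊎ LtSqrt c d
  ge-or-lt c d with c <? + 0
  ... | yes c<0 = inj₂ (lt-neg c<0)
  ... | no c≮0 with d * d * D ≤? c * c
  ...   | yes h = inj₁ (ge-sq (≮⇒≥ c≮0) h)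
  ...   | no h  = inj₂ (lt-sq (≰⇒> h))

  le⇒¬gt : ∀ {c d} → LeSqrt c d → ¬ GtSqrt c d
  le⇒¬gt (le-neg c<0) (gt-sq c≥0 _) = ≤⇒≯ c≥0 c<0
  le⇒¬gt (le-sq h)    (gt-sq _ h')  = ≤⇒≯ h h'

  ge⇒¬lt : ∀ {c d} → GeSqrt c d → ¬ LtSqrt c d
  ge⇒¬lt (ge-sq c≥0 _) (lt-neg c<0) = ≤⇒≯ c≥0 c<0
  ge⇒¬lt (ge-sq _ h)   (lt-sq h')   = ≤⇒≯ h h'

  lt⇒le : ∀ {c d} → LtSqrt c d → LeSqrt c d
  lt⇒le (lt-neg c<0) = le-neg c<0
  lt⇒le (lt-sq h)    = le-sq (<⇒≤ h)

  gt⇒ge : ∀ {c d} → GtSqrt c d → GeSqrt c d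
  gt⇒ge (gt-sq c≥0 h) = ge-sq c≥0 (<⇒≤ h)

  gt⇒pos : ∀ {c d} → GtSqrt c d → Pos c
  gt⇒pos {c} {d} (gt-sq c≥0 h) = square-<⇒< c≥0 (≤-<-trans (nonNeg-* (nonNeg-square d) D≥0) h)

  private
    cert-cross : ∀ c₁ d₁ c₂ d₂ → c₂ * d₁ + (+ 0 - c₁ - + 1) * d₂ + d₂ ≡ c₂ * d₁ - c₁ * d₂
    cert-cross = solve-∀
    cert-cross² : ∀ c₁ d₁ c₂ d₂ D → d₁ * d₁ * (c₂ * c₂ - d₂ * d₂ * D) + d₂ * d₂ * (d₁ * d₁ * D - c₁ * c₁)
               ≡ (c₂ * d₁) * (c₂ * d₁) - (c₁ * d₂) * (c₁ * d₂)
    cert-cross² = solve-∀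
    cert-crossˡ : ∀ c₁ d₁ c₂ d₂ → c₂ * d₁ + (+ 0 - c₁ - + 1) * d₂ + (d₂ - + 0 - + 1) ≡ c₂ * d₁ - c₁ * d₂ - + 1
    cert-crossˡ = solve-∀
    cert-crossˡ² : ∀ c₁ d₁ c₂ d₂ D → d₁ * d₁ * (c₂ * c₂ - d₂ * d₂ * D) + d₂ * d₂ * (d₁ * d₁ * D - c₁ * c₁ - + 1)
               + ((d₂ - + 0 - + 1) * (d₂ - + 0 - + 1) + (d₂ - + 0 - + 1) + (d₂ - + 0 - + 1))
               ≡ (c₂ * d₁) * (c₂ * d₁) - (c₁ * d₂) * (c₁ * d₂) - + 1
    cert-crossˡ² = solve-∀
    cert-crossʳ : ∀ c₁ d₁ c₂ d₂ → (c₂ - + 0 - + 1) * d₁ + (d₁ - + 0 - + 1) + (+ 0 - c₁ - + 1) * d₂ + d₂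
              ≡ c₂ * d₁ - c₁ * d₂ - + 1
    cert-crossʳ = solve-∀
    cert-crossʳ² : ∀ c₁ d₁ c₂ d₂ D → d₁ * d₁ * (c₂ * c₂ - d₂ * d₂ * D - + 1) + d₂ * d₂ * (d₁ * d₁ * D - c₁ * c₁)
               + ((d₁ - + 0 - + 1) * (d₁ - + 0 - + 1) + (d₁ - + 0 - + 1) + (d₁ - + 0 - + 1))
               ≡ (c₂ * d₁) * (c₂ * d₁) - (c₁ * d₂) * (c₁ * d₂) - + 1
    cert-crossʳ² = solve-∀

  cross-≤ : ∀ {c₁ d₁ c₂ d₂} → NonNeg d₁ → NonNeg d₂ → LeSqrt c₁ d₁ → GeSqrt c₂ d₂ → c₁ * d₂ ≤ c₂ * d₁
  cross-≤ {c₁} {d₁} {c₂} {d₂} d₁≥0 d₂≥0 le (ge-sq c₂≥0 h₂) with c₁ <? + 0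
  ... | yes c₁<0 = ≤-by _ (nonNeg-+ (nonNeg-+ (nonNeg-* c₂≥0 d₁≥0) (nonNeg-* (<-gap c₁<0) d₂≥0)) d₂≥0)
                          (cert-cross c₁ d₁ c₂ d₂)
  ... | no c₁≮0 with le
  ...   | le-neg c₁<0 = ⊥-elim (c₁≮0 c₁<0)
  ...   | le-sq h₁ = square-≤⇒≤ (nonNeg-* (≮⇒≥ c₁≮0) d₂≥0) (nonNeg-* c₂≥0 d₁≥0)
                       (≤-by _ (nonNeg-+ (nonNeg-* (nonNeg-square d₁) (≤-gap h₂))
                                         (nonNeg-* (nonNeg-square d₂) (≤-gap h₁)))
                               (cert-cross² c₁ d₁ c₂ d₂ D))

  cross-<ˡ : ∀ {c₁ d₁ c₂ d₂} → NonNeg d₁ → Pos d₂ → LtSqrt c₁ d₁ → GeSqrt c₂ d₂ → c₁ * d₂ < c₂ * d₁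
  cross-<ˡ {c₁} {d₁} {c₂} {d₂} d₁≥0 d₂>0 lt (ge-sq c₂≥0 h₂) with c₁ <? + 0
  ... | yes c₁<0 = <-by _ (nonNeg-+ (nonNeg-+ (nonNeg-* c₂≥0 d₁≥0) (nonNeg-* (<-gap c₁<0) (pos⇒nonNeg d₂>0)))
                                    (<-gap d₂>0))
                          (cert-crossˡ c₁ d₁ c₂ d₂)
  ... | no c₁≮0 with lt
  ...   | lt-neg c₁<0 = ⊥-elim (c₁≮0 c₁<0)
  ...   | lt-sq h₁ = square-<⇒< (nonNeg-* c₂≥0 d₁≥0)
                       (<-by _ (nonNeg-+ (nonNeg-+ (nonNeg-* (nonNeg-square d₁) (≤-gap h₂))
                                                   (nonNeg-* (nonNeg-square d₂) (<-gap h₁)))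
                                         (nonNeg-+ (nonNeg-+ (nonNeg-* g g) g) g))
                               (cert-crossˡ² c₁ d₁ c₂ d₂ D))
    where g = <-gap d₂>0

  cross-<ʳ : ∀ {c₁ d₁ c₂ d₂} → Pos d₁ → NonNeg d₂ → LeSqrt c₁ d₁ → GtSqrt c₂ d₂ → c₁ * d₂ < c₂ * d₁
  cross-<ʳ {c₁} {d₁} {c₂} {d₂} d₁>0 d₂≥0 le gt@(gt-sq c₂≥0 h₂) with c₁ <? + 0
  ... | yes c₁<0 = <-by _ (nonNeg-+ (nonNeg-+ (nonNeg-+ (nonNeg-* (<-gap (gt⇒pos gt)) (pos⇒nonNeg d₁>0))
                                                         (<-gap d₁>0))
                                               (nonNeg-* (<-gap c₁<0) d₂≥0)) d₂≥0)
                          (cert-crossʳ c₁ d₁ c₂ d₂)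
  ... | no c₁≮0 with le
  ...   | le-neg c₁<0 = ⊥-elim (c₁≮0 c₁<0)
  ...   | le-sq h₁ = square-<⇒< (nonNeg-* c₂≥0 (pos⇒nonNeg d₁>0))
                       (<-by _ (nonNeg-+ (nonNeg-+ (nonNeg-* (nonNeg-square d₁) (<-gap h₂))
                                                   (nonNeg-* (nonNeg-square d₂) (≤-gap h₁)))
                                         (nonNeg-+ (nonNeg-+ (nonNeg-* g g) g) g))
                               (cert-crossʳ² c₁ d₁ c₂ d₂ D))
    where g = <-gap d₁>0

  private
    cert-mediant⁺ : ∀ c₁ d₁ c₂ d₂ → (c₁ * (d₁ + d₂) - (c₁ + c₂) * d₁ - + 1) + (c₂ * (d₁ + d₂) - (c₁ + c₂) * d₂)
                    ≡ - + 1
    cert-mediant⁺ = solve-∀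
    cert-mediant⁻ : ∀ c₁ d₁ c₂ d₂ → ((c₁ + c₂) * d₁ - c₁ * (d₁ + d₂) - + 1) + ((c₁ + c₂) * d₂ - c₂ * (d₁ + d₂))
                    ≡ - + 1
    cert-mediant⁻ = solve-∀

  mediant-gt : ∀ {c₁ d₁ c₂ d₂} → NonNeg d₁ → NonNeg d₂ → Pos (d₁ + d₂) →
               GtSqrt c₁ d₁ → GeSqrt c₂ d₂ → GtSqrt (c₁ + c₂) (d₁ + d₂)
  mediant-gt {c₁} {d₁} {c₂} {d₂} d₁≥0 d₂≥0 d>0 gt₁ ge₂ with le-or-gt (c₁ + c₂) (d₁ + d₂)
  ... | inj₂ gt = gt
  ... | inj₁ le = ⊥-elim (¬nonNeg-1 (subst NonNeg (cert-mediant⁺ c₁ d₁ c₂ d₂)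
          (nonNeg-+ (<-gap (cross-<ʳ d>0 d₁≥0 le gt₁)) (≤-gap (cross-≤ (pos⇒nonNeg d>0) d₂≥0 le ge₂)))))

  mediant-lt : ∀ {c₁ d₁ c₂ d₂} → NonNeg d₁ → NonNeg d₂ → Pos (d₁ + d₂) →
               LtSqrt c₁ d₁ → LeSqrt c₂ d₂ → LtSqrt (c₁ + c₂) (d₁ + d₂)
  mediant-lt {c₁} {d₁} {c₂} {d₂} d₁≥0 d₂≥0 d>0 lt₁ le₂ with ge-or-lt (c₁ + c₂) (d₁ + d₂)
  ... | inj₂ lt = lt
  ... | inj₁ ge = ⊥-elim (¬nonNeg-1 (subst NonNeg (cert-mediant⁻ c₁ d₁ c₂ d₂)
          (nonNeg-+ (<-gap (cross-<ˡ d₁≥0 d>0 lt₁ ge)) (≤-gap (cross-≤ d₂≥0 (pos⇒nonNeg d>0) le₂ ge)))))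

  module Irrational (irr : ∀ c d → Pos d → c * c ≢ d * d * D) where
    le⇒lt : ∀ {c d} → Pos d → LeSqrt c d → LtSqrt c d
    le⇒lt d>0 (le-neg c<0) = lt-neg c<0
    le⇒lt {c} {d} d>0 (le-sq h) = lt-sq (≤∧≢⇒< h (irr c d d>0))

  private
    cert-square-mono : ∀ c c' → (c' - c) * (c' - c) + (c + c) * (c' - c) ≡ c' * c' - c * c
    cert-square-mono = solve-∀

  ge-mono : ∀ {c c' d} → GeSqrt c d → c ≤ c' → GeSqrt c' d
  ge-mono {c} {c'} (ge-sq c≥0 h) c≤c' =
    ge-sq (≤-trans c≥0 c≤c')
          (≤-trans h (≤-by _ (nonNeg-+ (nonNeg-square (c' - c)) (nonNeg-* (nonNeg-+ c≥0 c≥0) (≤-gap c≤c')))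
                              (cert-square-mono c c')))

  le-anti : ∀ {c c' d} → LeSqrt c d → c' ≤ c → LeSqrt c' d
  le-anti (le-neg c<0) c'≤c = le-neg (≤-<-trans c'≤c c<0)
  le-anti {c} {c'} (le-sq h) c'≤c with c' <? + 0
  ... | yes c'<0 = le-neg c'<0
  ... | no c'≮0 = le-sq (≤-trans (≤-by _ (nonNeg-+ (nonNeg-square (c - c')) (nonNeg-* (nonNeg-+ c'≥0 c'≥0) (≤-gap c'≤c)))
                                         (cert-square-mono c' c)) h)
    where c'≥0 = ≮⇒≥ c'≮0

  nonPos⇒le : ∀ {c d} → c ≤ + 0 → LeSqrt c d
  nonPos⇒le {c} {d} c≤0 with c <? + 0
  ... | yes c<0 = le-neg c<0
  ... | no c≮0 = le-sq (subst (λ z → z * z ≤ d * d * D) (sym (≤-antisym c≤0 (≮⇒≥ c≮0)))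
                              (nonNeg-* (nonNeg-square d) D≥0))

-- √D is irrational when D lies strictly between two consecutive squares
-- s² < D < (s+1)².  Descent: from c² = d²D with d > 0 one gets s d < |c| < (s+1) d,
-- and (c', d') = (D d - s|c|, |c| - s d) is a smaller solution, 0 < d' < d.
module Irrationality where
  open import Data.Nat as ℕ using (ℕ)
  import Data.Nat.Properties as ℕP
  open import Data.Nat.Induction using (<-rec)
  open import Data.Integer
  open import Data.Integer.Properties
  open import Data.Integer.Tactic.RingSolver using (solve-∀)
  open import Relation.Binary.PropositionalEquality
  open import Data.Sum using (inj₁; inj₂)
  open IntegerSigns

  private
    cert-descent : ∀ c d s D → (D * d - s * c) * (D * d - s * c)
                   ≡ (c - s * d) * (c - s * d) * D + (D - s * s) * (D * (d * d) - c * c)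
    cert-descent = solve-∀
    cancel-zero : ∀ X d D s → X + (D - s * s) * (D * (d * d) - d * d * D) ≡ X
    cancel-zero = solve-∀
    square-* : ∀ s d → (s * d) * (s * d) ≡ d * d * (s * s)
    square-* = solve-∀
    square-*-suc : ∀ s d → d * d * ((s + + 1) * (s + + 1)) ≡ ((s + + 1) * d) * ((s + + 1) * d)
    square-*-suc = solve-∀
    gap-d' : ∀ C s d → (s + + 1) * d - C - + 1 ≡ d - (C - s * d) - + 1
    gap-d' = solve-∀
    gap-pos : ∀ C s d → C - s * d - + 1 ≡ C - s * d - + 0 - + 1
    gap-pos = solve-∀

  ∣-∣-square : ∀ c → + ∣ c ∣ * + ∣ c ∣ ≡ c * c
  ∣-∣-square (+ n)    = refl
  ∣-∣-square -[1+ n ] = refl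

  descent : ∀ (c d s D : ℤ) → c * c ≡ d * d * D →
            (D * d - s * c) * (D * d - s * c) ≡ (c - s * d) * (c - s * d) * D
  descent c d s D e = begin
    (D * d - s * c) * (D * d - s * c)            ≡⟨ cert-descent c d s D ⟩
    X + (D - s * s) * (D * (d * d) - c * c)      ≡⟨ cong (λ z → X + (D - s * s) * (D * (d * d) - z)) e ⟩
    X + (D - s * s) * (D * (d * d) - d * d * D)  ≡⟨ cancel-zero X d D s ⟩
    X                                            ∎
    where open ≡-Reasoning
          X = (c - s * d) * (c - s * d) * D

  module _ (D s : ℤ) (s≥0 : NonNeg s) (s²<D : s * s < D) (D<[s+1]² : D < (s + + 1) * (s + + 1)) where

    irrational-ℕ : ∀ d → 0 ℕ.< d → ∀ c → c * c ≢ + d * + d * D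
    irrational-ℕ = <-rec _ step
      where
      step : ∀ d → (∀ {d'} → d' ℕ.< d → 0 ℕ.< d' → ∀ c → c * c ≢ + d' * + d' * D) →
             0 ℕ.< d → ∀ c → c * c ≢ + d * + d * D
      step d smaller 0<d c e = smaller d'<d 0<d' (D * δ - s * C) e'
        where
        δ = + d
        C = + ∣ c ∣
        eC : C * C ≡ δ * δ * D
        eC = trans (∣-∣-square c) e
        δ²>0 : Pos (δ * δ)
        δ²>0 = pos-*-pos (+<+ 0<d) (+<+ 0<d)
        -- s d < |c| < (s+1) d, from s² < D < (s+1)².
        sd<C : s * δ < C
        sd<C = square-<⇒< (nonNeg-ℕ ∣ c ∣)
                 (subst₂ _<_ (sym (square-* s δ)) (sym eC) (*-monoˡ-<-Pos δ²>0 s²<D))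
        C<[s+1]d : C < (s + + 1) * δ
        C<[s+1]d = square-<⇒< (nonNeg-* (nonNeg-+ s≥0 (nonNeg-ℕ 1)) (nonNeg-ℕ d))
                     (subst₂ _<_ (sym eC) (square-*-suc s δ) (*-monoˡ-<-Pos δ²>0 D<[s+1]²))
        d'ℤ = C - s * δ
        d'ℤ>0 : Pos d'ℤ
        d'ℤ>0 = <-by _ (<-gap sd<C) (gap-pos C s δ)
        +∣d'∣≡d' : + ∣ d'ℤ ∣ ≡ d'ℤ
        +∣d'∣≡d' = 0≤i⇒+∣i∣≡i (pos⇒nonNeg d'ℤ>0)
        d'<d : ∣ d'ℤ ∣ ℕ.< d
        d'<d = drop‿+<+ (subst (_< δ) (sym +∣d'∣≡d')
                 (<-by _ (subst NonNeg (gap-d' C s δ) (<-gap C<[s+1]d)) refl))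
        0<d' : 0 ℕ.< ∣ d'ℤ ∣
        0<d' = drop‿+<+ (subst (+ 0 <_) (sym +∣d'∣≡d') d'ℤ>0)
        e' : (D * δ - s * C) * (D * δ - s * C) ≡ + ∣ d'ℤ ∣ * + ∣ d'ℤ ∣ * D
        e' = trans (descent C δ s D eC) (cong (λ z → z * z * D) (sym +∣d'∣≡d'))

    irrational : ∀ c d → Pos d → c * c ≢ d * d * D
    irrational c (+ d) (+<+ 0<d) = irrational-ℕ d 0<d c

  private
    gap-below : ∀ K → K * K + + 4 - K * K - + 1 ≡ + 3
    gap-below = solve-∀
    gap-above : ∀ K → + 2 * (K - + 2) ≡ (K + + 1) * (K + + 1) - (K * K + + 4) - + 1
    gap-above = solve-∀

  -- √(K²+4) is irrational for K ≥ 1:  5 lies between 2² and 3², and for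
  -- K ≥ 2 the number K²+4 lies strictly between K² and (K+1)².
  √[K²+4]-irrational : ∀ K → 1 ℕ.≤ K → ∀ c d → Pos d → c * c ≢ d * d * (+ K * + K + + 4)
  √[K²+4]-irrational K K≥1 with ℕP.m≤n⇒m<n∨m≡n K≥1
  ... | inj₂ refl = irrational (+ 5) (+ 2) (nonNeg-ℕ 2) (+<+ (ℕP.n<1+n 4)) (+<+ (ℕP.m≤m+n 6 3))
  ... | inj₁ K≥2 = irrational (+ K * + K + + 4) (+ K) (nonNeg-ℕ K) (<-by _ (nonNeg-ℕ 3) (sym (gap-below (+ K))))
                     (<-by _ (nonNeg-* (nonNeg-ℕ 2) (≤-gap (+≤+ K≥2))) (gap-above (+ K)))

module SucClosure where
  open import Data.Nat
  open import Data.Nat.Properties using (m≤n⇒m<n∨m≡n)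
  open import Data.Sum using (inj₁; inj₂)
  open import Relation.Binary.PropositionalEquality using (refl)

  upward : (Q : ℕ → Set) → (∀ {n} → Q n → Q (suc n)) → ∀ {n n'} → n ≤ n' → Q n → Q n'
  upward Q step {n' = zero} z≤n q = q
  upward Q step {n' = suc n'} n≤ q with m≤n⇒m<n∨m≡n n≤
  ... | inj₁ (s≤s n≤n') = step (upward Q step n≤n' q)
  ... | inj₂ refl = q

  downward : (Q : ℕ → Set) → (∀ {n} → Q (suc n) → Q n) → ∀ {n n'} → n ≤ n' → Q n' → Q n
  downward Q step {n' = zero} z≤n q = q
  downward Q step {n' = suc n'} n≤ q with m≤n⇒m<n∨m≡n n≤
  ... | inj₁ (s≤s n≤n') = downward Q step n≤n' (step q)
  ... | inj₂ refl = q

-- Since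
-- (√D + k - 2)(√D - k + 2) = 4k = (k + 2 + √D)(k + 2 - √D) with D = k² + 4,
--   v ≤ a_j  ⟺  p v (√D + k - 2) ≤ 2 k j  ⟺  p v √D ≤ 2 k j - p v (k - 2),
--   v ≤ b_i  ⟺  p v (k + 2 - √D) ≤ 2 k i  ⟺  p v (k + 2) - 2 k i ≤ p v √D.
-- These forms are linear in j (resp. i), which makes the counting arguments easy.
module BeattyPair (m p : Data.Nat.ℕ) (m≥1 : 1 Data.Nat.≤ m) (p≥1 : 1 Data.Nat.≤ p) where
  open import Data.Nat as ℕ using (ℕ; zero; suc)
  import Data.Nat.Properties as ℕP
  open import Data.Integer hiding (suc; pred)
  open import Data.Integer.Properties
  open import Data.Integer.Tactic.RingSolver using (solve-∀)
  open import Relation.Binary.PropositionalEquality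
  open import Data.Sum using (inj₁; inj₂)
  open import Data.Empty using (⊥-elim)
  open import Relation.Nullary using (¬_; yes; no; Dec)
  open IntegerSigns

  k : ℕ
  k = m ℕ.* p

  K P : ℤ
  K = + k
  P = + p

  D : ℤ
  D = K * K + + 4

  k≥1 : 1 ℕ.≤ k
  k≥1 = ℕP.*-mono-≤ m≥1 p≥1

  K>0 : Pos K
  K>0 = +<+ k≥1

  P>0 : Pos P
  P>0 = +<+ p≥1

  D≥0 : NonNeg D
  D≥0 = nonNeg-+ (nonNeg-square K) (nonNeg-ℕ 4)

  open SqrtComparison D D≥0 public
  open Irrational (Irrationality.√[K²+4]-irrational k k≥1) public

  pos-suc : ∀ n → Pos (+ suc n)
  pos-suc n = +<+ (ℕ.s≤s ℕ.z≤n)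

  4K>0 : Pos (+ 4 * K)
  4K>0 = pos-*-pos (pos-suc 3) K>0

  private
    cert-4x-1 : ∀ x → + 4 * (x - + 0 - + 1) + + 3 ≡ + 4 * x - + 1
    cert-4x-1 = solve-∀
    cert-2-K : ∀ K P → + 4 * (K * (P * P)) - + 1 ≡ P * P * (K * K + + 4) - P * (+ 2 - K) * (P * (+ 2 - K)) - + 1
    cert-2-K = solve-∀
    cert-K+2 : ∀ K P → + 4 * (K * (P * P)) - + 1 ≡ P * (K + + 2) * (P * (K + + 2)) - P * P * (K * K + + 4) - + 1
    cert-K+2 = solve-∀
    cert-2 : ∀ K → K * K - + 0 - + 1 ≡ + 1 * + 1 * (K * K + + 4) - + 2 * + 2 - + 1
    cert-2 = solve-∀
    cert-K²+K+2 : ∀ K → + 4 * K - + 1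
                  ≡ (K + + 1) * (K + + 1) * (K * K + + 4) - (K * K + K + + 2) * (K * K + K + + 2) - + 1
    cert-K²+K+2 = solve-∀

  4x-1≥0 : ∀ {x} → Pos x → NonNeg (+ 4 * x - + 1)
  4x-1≥0 {x} x>0 = subst NonNeg (cert-4x-1 x) (nonNeg-+ (nonNeg-* (nonNeg-ℕ 4) (<-gap x>0)) (nonNeg-ℕ 3))

  KP²>0 : Pos (K * (P * P))
  KP²>0 = pos-*-pos K>0 (pos-*-pos P>0 P>0)

  2-K<√D : LtSqrt (P * (+ 2 - K)) P
  2-K<√D = lt-sq (<-by _ (4x-1≥0 KP²>0) (cert-2-K K P))

  K+2>√D : GtSqrt (P * (K + + 2)) P
  K+2>√D = gt-sq (nonNeg-* (nonNeg-ℕ p) (nonNeg-ℕ (k ℕ.+ 2))) (<-by _ (4x-1≥0 KP²>0) (cert-K+2 K P))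

  2<√D : LtSqrt (+ 2) (+ 1)
  2<√D = lt-sq (<-by _ (<-gap (pos-*-pos K>0 K>0)) (cert-2 K))

  K²+K+2<[K+1]√D : LtSqrt (K * K + K + + 2) (K + + 1)
  K²+K+2<[K+1]√D = lt-sq (<-by _ (4x-1≥0 K>0) (cert-K²+K+2 K))

  -- UnderA j v :  v ≤ a_j,  i.e.  p v √D ≤ numA j v;
  -- UnderB i v :  v ≤ b_i,  i.e.  numB i v ≤ p v √D.
  numA numB : ℕ → ℕ → ℤ
  numA j v = + 2 * K * + j - P * + v * (K - + 2)
  numB i v = P * + v * (K + + 2) - + 2 * K * + i

  den : ℕ → ℤ
  den v = P * + v

  UnderA UnderB : ℕ → ℕ → Set
  UnderA j v = GeSqrt (numA j v) (den v)
  UnderB i v = LeSqrt (numB i v) (den v)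

  UnderA? : ∀ j v → Dec (UnderA j v)
  UnderA? j v with ge-or-lt (numA j v) (den v)
  ... | inj₁ ge = yes ge
  ... | inj₂ lt = no (λ ge → ge⇒¬lt ge lt)

  UnderB? : ∀ i v → Dec (UnderB i v)
  UnderB? i v with le-or-gt (numB i v) (den v)
  ... | inj₁ le = yes le
  ... | inj₂ gt = no (λ le → le⇒¬gt le gt)

  den≥0 : ∀ v → NonNeg (den v)
  den≥0 v = nonNeg-* (nonNeg-ℕ p) (nonNeg-ℕ v)

  den>0 : ∀ v → Pos (den (suc v))
  den>0 v = pos-*-pos P>0 (pos-suc v)

  private
    cert-j : ∀ K P J V → + 2 * K ≡ (+ 2 * K * (+ 1 + J) - P * V * (K - + 2)) - (+ 2 * K * J - P * V * (K - + 2))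
    cert-j = solve-∀
    cert-i : ∀ K P I V → + 2 * K ≡ (P * V * (K + + 2) - + 2 * K * I) - (P * V * (K + + 2) - + 2 * K * (+ 1 + I))
    cert-i = solve-∀
    numA-suc : ∀ K P J V → P * (+ 2 - K) + (+ 2 * K * J - P * V * (K - + 2)) ≡ + 2 * K * J - P * (+ 1 + V) * (K - + 2)
    numA-suc = solve-∀
    numB-suc : ∀ K P I V → P * (K + + 2) + (P * V * (K + + 2) - + 2 * K * I) ≡ P * (+ 1 + V) * (K + + 2) - + 2 * K * I
    numB-suc = solve-∀
    den-suc : ∀ P V → P + P * V ≡ P * (+ 1 + V)
    den-suc = solve-∀

  UnderA-suc-j : ∀ {j v} → UnderA j v → UnderA (suc j) v
  UnderA-suc-j {j} {v} u = ge-mono u (≤-by _ (nonNeg-* (nonNeg-ℕ 2) (nonNeg-ℕ k)) (cert-j K P (+ j) (+ v)))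

  UnderB-suc-i : ∀ {i v} → UnderB i v → UnderB (suc i) v
  UnderB-suc-i {i} {v} u = le-anti u (≤-by _ (nonNeg-* (nonNeg-ℕ 2) (nonNeg-ℕ k)) (cert-i K P (+ i) (+ v)))

  -- Downward closure in v: the bound for v+1 is the mediant of the bound for v
  -- and of 2 - k < √D (resp. k + 2 > √D).
  UnderA-pred-v : ∀ {j v} → UnderA j (suc v) → UnderA j v
  UnderA-pred-v {j} {v} u with ge-or-lt (numA j v) (den v)
  ... | inj₁ ge = ge
  ... | inj₂ lt = ⊥-elim (ge⇒¬lt u (subst₂ LtSqrt (numA-suc K P (+ j) (+ v)) (den-suc P (+ v))
                    (mediant-lt (nonNeg-ℕ p) (den≥0 v) (subst Pos (sym (den-suc P (+ v))) (den>0 v))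
                                2-K<√D (lt⇒le lt))))

  UnderB-pred-v : ∀ {i v} → UnderB i (suc v) → UnderB i v
  UnderB-pred-v {i} {v} u with le-or-gt (numB i v) (den v)
  ... | inj₁ le = le
  ... | inj₂ gt = ⊥-elim (le⇒¬gt u (subst₂ GtSqrt (numB-suc K P (+ i) (+ v)) (den-suc P (+ v))
                    (mediant-gt (nonNeg-ℕ p) (den≥0 v) (subst Pos (sym (den-suc P (+ v))) (den>0 v))
                                K+2>√D (gt⇒ge gt))))

  UnderA-mono-j : ∀ {j j' v} → j ℕ.≤ j' → UnderA j v → UnderA j' v
  UnderA-mono-j {v = v} = SucClosure.upward (λ j → UnderA j v) UnderA-suc-j

  UnderB-mono-i : ∀ {i i' v} → i ℕ.≤ i' → UnderB i v → UnderB i' v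
  UnderB-mono-i {v = v} = SucClosure.upward (λ i → UnderB i v) UnderB-suc-i

  UnderA-anti-v : ∀ {j v v'} → v ℕ.≤ v' → UnderA j v' → UnderA j v
  UnderA-anti-v {j} = SucClosure.downward (UnderA j) UnderA-pred-v

  UnderB-anti-v : ∀ {i v v'} → v ℕ.≤ v' → UnderB i v' → UnderB i v
  UnderB-anti-v {i} = SucClosure.downward (UnderB i) UnderB-pred-v

  private
    cert-A0 : ∀ K P J → + 2 * K * J ≡ (+ 2 * K * J - P * + 0 * (K - + 2)) - + 0
    cert-A0 = solve-∀
    cert-A0² : ∀ K P J D → (+ 2 * K * J) * (+ 2 * K * J)
               ≡ (+ 2 * K * J - P * + 0 * (K - + 2)) * (+ 2 * K * J - P * + 0 * (K - + 2)) - P * + 0 * (P * + 0) * D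
    cert-A0² = solve-∀
    cert-B0 : ∀ K P I → + 2 * K * I ≡ + 0 - (P * + 0 * (K + + 2) - + 2 * K * I)
    cert-B0 = solve-∀
    cert-a₀ : ∀ K d → ((+ 2 * K * + 0 - d * (K - + 2)) * (+ 2 * K * + 0 - d * (K - + 2)) - d * d * (K * K + + 4))
                      + (+ 4 * K) * (d * d) ≡ + 0
    cert-a₀ = solve-∀
    cert-b₀ : ∀ K d → (d * d * (K * K + + 4) - (d * (K + + 2) - + 2 * K * + 0) * (d * (K + + 2) - + 2 * K * + 0))
                      + (+ 4 * K) * (d * d) ≡ + 0
    cert-b₀ = solve-∀
    cert-b₀-sign : ∀ K d → d * (K + + 2) ≡ d * (K + + 2) - + 2 * K * + 0 - + 0
    cert-b₀-sign = solve-∀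
    cert-sum : ∀ x y → x + (y - + 0 - + 1) ≡ (x + y) - + 1
    cert-sum = solve-∀

  nonNeg+pos≢0 : ∀ {x y} → NonNeg x → Pos y → x + y ≢ + 0
  nonNeg+pos≢0 {x} {y} x≥0 y>0 e =
    ¬nonNeg-1 (subst NonNeg (trans (cert-sum x y) (cong (_- + 1) e)) (nonNeg-+ x≥0 (<-gap y>0)))

  UnderA-0 : ∀ j → UnderA j 0
  UnderA-0 j = ge-sq (≤-by _ (nonNeg-* (nonNeg-* (nonNeg-ℕ 2) (nonNeg-ℕ k)) (nonNeg-ℕ j)) (cert-A0 K P (+ j)))
                     (≤-by _ (nonNeg-square (+ 2 * K * + j)) (cert-A0² K P (+ j) D))

  UnderB-0 : ∀ i → UnderB i 0
  UnderB-0 i = nonPos⇒le (≤-by _ (nonNeg-* (nonNeg-* (nonNeg-ℕ 2) (nonNeg-ℕ k)) (nonNeg-ℕ i)) (cert-B0 K P (+ i)))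

  a₀-zero : ∀ v → ¬ UnderA 0 (suc v)
  a₀-zero v (ge-sq _ h) = nonNeg+pos≢0 (≤-gap h) (pos-*-pos 4K>0 (pos-*-pos (den>0 v) (den>0 v))) (cert-a₀ K (den (suc v)))

  b₀-zero : ∀ v → ¬ UnderB 0 (suc v)
  b₀-zero v (le-neg c<0) = ≤⇒≯ (≤-by _ (nonNeg-* (den≥0 (suc v)) (nonNeg-ℕ (k ℕ.+ 2))) (cert-b₀-sign K (den (suc v)))) c<0
  b₀-zero v (le-sq h) = nonNeg+pos≢0 (≤-gap h) (pos-*-pos 4K>0 (pos-*-pos (den>0 v) (den>0 v))) (cert-b₀ K (den (suc v)))

  private
    cert-a≤b : ∀ K P I V → (P * V * (K + + 2) - + 2 * K * I + (+ 2 * K * I - P * V * (K - + 2))) * + 1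
                           - + 2 * (P * V + P * V) - + 1 ≡ - + 1
    cert-a≤b = solve-∀

  -- a_j ≤ b_j: otherwise √D would lie below the mediant of the two bounds,
  -- which is (4 p v)/(2 p v) = 2 < √D.
  UnderA⇒UnderB : ∀ {j v} → UnderA j v → UnderB j v
  UnderA⇒UnderB {j} {zero} _ = UnderB-0 j
  UnderA⇒UnderB {j} {suc v} u with le-or-gt (numB j (suc v)) (den (suc v))
  ... | inj₁ le = le
  ... | inj₂ gt = ⊥-elim (¬nonNeg-1 (subst NonNeg (cert-a≤b K P (+ j) (+ suc v)) (<-gap 2<mediant)))
    where
    d≥0 = den≥0 (suc v)
    sum>√D = mediant-gt d≥0 d≥0 (+-mono-<-≤ (den>0 v) d≥0) gt u
    2<mediant = cross-<ʳ (pos-suc 0) (nonNeg-+ d≥0 d≥0) (lt⇒le 2<√D) sum>√D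

  private
    cert-growth : ∀ K P J V → (+ 2 * K * J - P * V * (K - + 2)) * (K + + 1) - (K * K + K + + 2) * (P * V) - + 1
                  ≡ (+ 2 * K) * ((K + + 1) * J - K * (P * V)) - + 0 - + 1
    cert-growth = solve-∀
    cert-gap : ∀ x y → (y - x) - + 0 - + 1 ≡ y - x - + 1
    cert-gap = solve-∀

  -- Growth bound φ < (k+1)/k:  v ≤ a_j with v ≥ 1 forces k p v < (k+1) j.
  UnderA-growth : ∀ {j v} → UnderA j (suc v) → k ℕ.* (p ℕ.* suc v) ℕ.< (k ℕ.+ 1) ℕ.* j
  UnderA-growth {j} {v} u = drop‿+<+ (subst₂ _<_ (sym lhs) (sym rhs)
                              (<-by _ (subst NonNeg (cert-gap (K * (P * + suc v)) ((K + + 1) * + j)) (<-gap gap>0)) refl))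
    where
    crossed = cross-<ˡ (nonNeg-+ (nonNeg-ℕ k) (nonNeg-ℕ 1)) (den>0 v) K²+K+2<[K+1]√D u
    gap>0 : Pos ((K + + 1) * + j - K * (P * + suc v))
    gap>0 = pos-cancelˡ (nonNeg-* (nonNeg-ℕ 2) (nonNeg-ℕ k))
              (<-by _ (subst NonNeg (cert-growth K P (+ j) (+ suc v)) (<-gap crossed)) refl)
    lhs : + (k ℕ.* (p ℕ.* suc v)) ≡ K * (P * + suc v)
    lhs = trans (pos-* k (p ℕ.* suc v)) (cong (K *_) (pos-* p (suc v)))
    rhs : + ((k ℕ.+ 1) ℕ.* j) ≡ (K + + 1) * + j
    rhs = trans (pos-* (k ℕ.+ 1) j) (cong (_* + j) (pos-+ k 1))

  pos-∸ : ∀ {a b} → b ℕ.≤ a → + (a ℕ.∸ b) ≡ + a - + b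
  pos-∸ {a} {b} b≤a = sym (trans ([+m]-[+n]≡m⊖n a b) (⊖-≥ b≤a))

  private
    cert-reflect : ∀ K P V I → + 2 * K * (P * V - I) - P * V * (K - + 2) ≡ P * V * (K + + 2) - + 2 * K * I
    cert-reflect = solve-∀

  numA-reflect : ∀ i v → i ℕ.≤ p ℕ.* v → numA (p ℕ.* v ℕ.∸ i) v ≡ numB i v
  numA-reflect i v i≤pv =
    trans (cong (λ z → + 2 * K * z - P * + v * (K - + 2)) (trans (pos-∸ i≤pv) (cong (_- + i) (pos-* p v))))
          (cert-reflect K P (+ v) (+ i))

  -- The reflection behind the complementarity of a and b:
  --   v ≤ b_i  ⟺  ¬ (v ≤ a_{pv-i})      (for 0 ≤ i ≤ p v, using irrationality).
  UnderB⇒¬UnderA-reflect : ∀ {i v} → i ℕ.≤ p ℕ.* suc v → UnderB i (suc v) → ¬ UnderA (p ℕ.* suc v ℕ.∸ i) (suc v)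
  UnderB⇒¬UnderA-reflect {i} {v} i≤ le ge =
    ge⇒¬lt (subst (λ c → GeSqrt c (den (suc v))) (numA-reflect i (suc v) i≤) ge) (le⇒lt (den>0 v) le)

  ¬UnderA⇒UnderB-reflect : ∀ {i v} → i ℕ.≤ p ℕ.* v → ¬ UnderA (p ℕ.* v ℕ.∸ i) v → UnderB i v
  ¬UnderA⇒UnderB-reflect {i} {v} i≤ ¬ge with ge-or-lt (numA (p ℕ.* v ℕ.∸ i) v) (den v)
  ... | inj₁ ge = ⊥-elim (¬ge ge)
  ... | inj₂ lt = lt⇒le (subst (λ c → LtSqrt c (den v)) (numA-reflect i v i≤) lt)

  private
    cert-top : ∀ K P V → + 2 * K * (P * V) - P * V * (K - + 2) ≡ (P * V) * (K + + 2)
    cert-top = solve-∀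
    cert-top² : ∀ K P V → (+ 4 * K) * ((P * V) * (P * V))
                ≡ ((P * V) * (K + + 2)) * ((P * V) * (K + + 2)) - P * V * (P * V) * (K * K + + 4)
    cert-top² = solve-∀

  -- v ≤ a_{pv}, since φ ≥ 1.
  UnderA-top : ∀ v → UnderA (p ℕ.* v) v
  UnderA-top v = subst (λ c → GeSqrt c (den v))
                   (sym (trans (cong (λ z → + 2 * K * z - P * + v * (K - + 2)) (pos-* p v)) (cert-top K P (+ v))))
                   (ge-sq (nonNeg-* (den≥0 v) (nonNeg-ℕ (k ℕ.+ 2)))
                          (≤-by _ (nonNeg-* (pos⇒nonNeg 4K>0) (nonNeg-square (den v))) (cert-top² K P (+ v))))

-- The linear forms of BeattyPair against the floor expressions of the statement:
-- multiplying by conjugates turns  Q ≤ J φ  into  Q √D ≤ 2kJ - Q(k-2)  and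
-- Q ≤ J (φ + k)  into  Q(k+2) - 2kJ ≤ Q √D.
module FloorForms (m p : Data.Nat.ℕ) (m≥1 : 1 Data.Nat.≤ m) (p≥1 : 1 Data.Nat.≤ p) where
  open import Data.Nat as ℕ using (suc)
  open import Data.Integer hiding (suc; pred)
  open import Data.Integer.Properties
  open import Data.Integer.Tactic.RingSolver using (solve-∀)
  open import Relation.Binary.PropositionalEquality
  open import Data.Sum using (inj₁; inj₂)
  open import Data.Product using (_,_)
  open import Data.Empty using (⊥-elim)
  open import Relation.Nullary using (¬_; yes; no)
  open import Defs using (IsA; IsB; LeMulSqrt)
  open IntegerSigns
  open BeattyPair m p m≥1 p≥1

  private
    conj-A : ∀ K J Q → (+ 2 * K * J - Q * (K - + 2)) * (+ 2 * K * J - Q * (K - + 2)) - Q * Q * (K * K + + 4)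
             ≡ K * (J * J * (K * K + + 4) - (+ 2 * Q - J * (+ 2 - K)) * (+ 2 * Q - J * (+ 2 - K)))
    conj-A = solve-∀
    cert-2J-Q⁻ : ∀ K J Q → (+ 0 - (+ 2 * Q - J * (+ 2 - K)) - + 1) + (+ 2 * J + J * K + + 1) ≡ + 2 * (+ 2 * J - Q)
    cert-2J-Q⁻ = solve-∀
    cert-[K+2]² : ∀ K J → J * (K + + 2) * (J * (K + + 2)) - J * J * (K * K + + 4) ≡ (+ 4 * K) * (J * J)
    cert-[K+2]² = solve-∀
    cert-2J-Q⁺ : ∀ K J Q → J * (K + + 2) - (+ 2 * Q - J * (+ 2 - K)) ≡ + 2 * (+ 2 * J - Q)
    cert-2J-Q⁺ = solve-∀
    cert-numA : ∀ K J Q → K * (+ 2 * J - Q) + + 2 * Q ≡ (+ 2 * K * J - Q * (K - + 2)) - + 0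
    cert-numA = solve-∀
    cert-sq-gap : ∀ K J c → J * J * (K * K + + 3) + (J + c) * (J + (+ 0 - c - + 1) + + 1) ≡ J * J * (K * K + + 4) - c * c
    cert-sq-gap = solve-∀
    cert-J+c : ∀ K J Q → + 2 * Q + J * (K - + 0 - + 1) ≡ J + (+ 2 * Q - J * (+ 2 - K))
    cert-J+c = solve-∀
    minus-zero : ∀ x → x - + 0 ≡ x
    minus-zero = solve-∀

  -- Conjugation for a:  Q ≤ J φ, written  2Q - J(2-k) ≤ J √D,  is equivalent to
  -- Q √D ≤ 2kJ - Q(k-2)  (multiply by the conjugate √D - k + 2).
  conjA⇒ : ∀ {J Q} → NonNeg J → NonNeg Q → LeSqrt (+ 2 * Q - J * (+ 2 - K)) J → GeSqrt (+ 2 * K * J - Q * (K - + 2)) Q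
  conjA⇒ {J} {Q} J≥0 Q≥0 le = ge-sq num≥0 (≤-by _ (nonNeg-* (nonNeg-ℕ k) (square-gap le)) (sym (conj-A K J Q)))
    where
    c = + 2 * Q - J * (+ 2 - K)
    -- Q ≤ J φ < 2 J
    Q≤2J : LeSqrt c J → NonNeg (+ 2 * J - Q)
    Q≤2J _ with c <? + 0
    ... | yes c<0 = nonNeg-cancelˡ (pos-suc 1) (subst NonNeg (cert-2J-Q⁻ K J Q)
                      (nonNeg-+ (<-gap c<0) (nonNeg-+ (nonNeg-+ (nonNeg-* (nonNeg-ℕ 2) J≥0) (nonNeg-* J≥0 (nonNeg-ℕ k))) (nonNeg-ℕ 1))))
    Q≤2J (le-neg c<0) | no c≮0 = ⊥-elim (c≮0 c<0)
    Q≤2J (le-sq h)    | no c≮0 = nonNeg-cancelˡ (pos-suc 1) (subst NonNeg (cert-2J-Q⁺ K J Q) (≤-gap c≤J[K+2]))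
      where
      c≤J[K+2] : c ≤ J * (K + + 2)
      c≤J[K+2] = square-≤⇒≤ (≮⇒≥ c≮0) (nonNeg-* J≥0 (nonNeg-ℕ (k ℕ.+ 2)))
                   (≤-trans h (≤-by _ (nonNeg-* (pos⇒nonNeg 4K>0) (nonNeg-square J)) (sym (cert-[K+2]² K J))))
    num≥0 : NonNeg (+ 2 * K * J - Q * (K - + 2))
    num≥0 = subst NonNeg (trans (cert-numA K J Q) (minus-zero _))
              (nonNeg-+ (nonNeg-* (nonNeg-ℕ k) (Q≤2J le)) (nonNeg-* (nonNeg-ℕ 2) Q≥0))
    -- c² ≤ J² D; for negative c this uses c ≥ -J.
    square-gap : LeSqrt c J → NonNeg (J * J * (K * K + + 4) - c * c)
    square-gap _ with c <? + 0
    ... | yes c<0 = subst NonNeg (cert-sq-gap K J c)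
                      (nonNeg-+ (nonNeg-* (nonNeg-square J) (nonNeg-+ (nonNeg-square K) (nonNeg-ℕ 3)))
                                (nonNeg-* (subst NonNeg (cert-J+c K J Q) (nonNeg-+ (nonNeg-* (nonNeg-ℕ 2) Q≥0) (nonNeg-* J≥0 (<-gap K>0))))
                                          (nonNeg-+ (nonNeg-+ J≥0 (<-gap c<0)) (nonNeg-ℕ 1))))
    square-gap (le-neg c<0) | no c≮0 = ⊥-elim (c≮0 c<0)
    square-gap (le-sq h)    | no c≮0 = ≤-gap h

  conjA⇐ : ∀ {J Q} → GeSqrt (+ 2 * K * J - Q * (K - + 2)) Q → LeSqrt (+ 2 * Q - J * (+ 2 - K)) J
  conjA⇐ {J} {Q} (ge-sq _ h) = le-sq (0≤i-j⇒j≤i (nonNeg-cancelˡ K>0 (subst NonNeg (conj-A K J Q) (≤-gap h))))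

  private
    conj-B : ∀ K J Q → Q * Q * (K * K + + 4) - (Q * (K + + 2) - + 2 * K * J) * (Q * (K + + 2) - + 2 * K * J)
             ≡ K * (J * J * (K * K + + 4) - (+ 2 * Q - J * (+ 2 + K)) * (+ 2 * Q - J * (+ 2 + K)))
    conj-B = solve-∀
    cert-numB : ∀ K J Q → + 2 * (Q * (K + + 2) - + 2 * K * J) ≡ J * (K * K + + 4) - (K + + 2) * (+ 0 - (+ 2 * Q - J * (+ 2 + K)))
    cert-numB = solve-∀
    cert-scaled : ∀ K J c → (J * (K * K + + 4) * (J * (K * K + + 4)) - ((K + + 2) * (+ 0 - c)) * ((K + + 2) * (+ 0 - c)))
                            + (J * J * (K * K + + 4)) * (+ 4 * K)
                          ≡ ((K + + 2) * (K + + 2)) * (J * J * (K * K + + 4) - c * c)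
    cert-scaled = solve-∀
    difference-of-squares : ∀ x y → (y - x) * (y + x) ≡ y * y - x * x
    difference-of-squares = solve-∀
    cert-neg : ∀ K J Q → J * (K * K + + 4) + + 2 * (+ 0 - (Q * (K + + 2) - + 2 * K * J) - + 1) + + 1
               ≡ (K + + 2) * (+ 0 - (+ 2 * Q - J * (+ 2 + K))) - + 0 - + 1
    cert-neg = solve-∀
    cert-opp : ∀ c → + 0 - c - + 1 ≡ + 0 - c - + 0 - + 1
    cert-opp = solve-∀

  K+2>0 : Pos (K + + 2)
  K+2>0 = +-mono-<-≤ K>0 (nonNeg-ℕ 2)

  -- Conjugation for b:  Q ≤ J (φ + k), i.e.  2Q - J(2+k) ≤ J √D,  is equivalent to
  -- Q(k+2) - 2kJ ≤ Q √D  (multiply by the conjugate k + 2 - √D).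
  conjB⇒ : ∀ {J Q} → NonNeg J → NonNeg Q → LeSqrt (+ 2 * Q - J * (+ 2 + K)) J → LeSqrt (Q * (K + + 2) - + 2 * K * J) Q
  conjB⇒ {J} {Q} J≥0 Q≥0 le with (+ 2 * Q - J * (+ 2 + K)) <? + 0
  conjB⇒ {J} {Q} J≥0 Q≥0 (le-neg c<0) | no c≮0 = ⊥-elim (c≮0 c<0)
  conjB⇒ {J} {Q} J≥0 Q≥0 (le-sq h)    | no c≮0 = le-sq (0≤i-j⇒j≤i (subst NonNeg (sym (conj-B K J Q)) (nonNeg-* (nonNeg-ℕ k) (≤-gap h))))
  conjB⇒ {J} {Q} J≥0 Q≥0 le | yes c<0 with (Q * (K + + 2) - + 2 * K * J) <? + 0
  ... | yes e<0 = le-neg e<0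
  ... | no e≮0 = le-sq (0≤i-j⇒j≤i (subst NonNeg (sym (conj-B K J Q)) (nonNeg-* (nonNeg-ℕ k) square-gap)))
    where
    c = + 2 * Q - J * (+ 2 + K)
    Z = (K + + 2) * (+ 0 - c)
    Z≥0 : NonNeg Z
    Z≥0 = nonNeg-* (pos⇒nonNeg K+2>0) (pos⇒nonNeg (<-by _ (subst NonNeg (cert-opp c) (<-gap c<0)) refl))
    Z≤JD : NonNeg (J * (K * K + + 4) - Z)
    Z≤JD = subst NonNeg (cert-numB K J Q) (nonNeg-* (nonNeg-ℕ 2) (≮⇒≥ e≮0))
    square-gap : NonNeg (J * J * (K * K + + 4) - c * c)
    square-gap = nonNeg-cancelˡ (pos-*-pos K+2>0 K+2>0) (subst NonNeg (cert-scaled K J c)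
                   (nonNeg-+ (subst NonNeg (difference-of-squares Z (J * (K * K + + 4))) (nonNeg-* Z≤JD (nonNeg-+ (nonNeg-* J≥0 D≥0) Z≥0)))
                             (nonNeg-* (nonNeg-* (nonNeg-square J) D≥0) (pos⇒nonNeg 4K>0))))

  conjB⇐ : ∀ {J Q} → NonNeg J → LeSqrt (Q * (K + + 2) - + 2 * K * J) Q → LeSqrt (+ 2 * Q - J * (+ 2 + K)) J
  conjB⇐ {J} {Q} J≥0 (le-neg e<0) = le-neg (<-by _ (<-gap (pos-cancelˡ (pos⇒nonNeg K+2>0)
     (<-by _ (nonNeg-+ (nonNeg-+ (nonNeg-* J≥0 D≥0) (nonNeg-* (nonNeg-ℕ 2) (<-gap e<0))) (nonNeg-ℕ 1)) (cert-neg K J Q))))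
     (sym (cert-opp (+ 2 * Q - J * (+ 2 + K)))))
  conjB⇐ {J} {Q} J≥0 (le-sq h) = le-sq (0≤i-j⇒j≤i (nonNeg-cancelˡ K>0 (subst NonNeg (conj-B K J Q) (≤-gap h))))

  private
    D-in-ℤ : ∀ s → + (s ℕ.* s ℕ.* (m ℕ.* p ℕ.* (m ℕ.* p) ℕ.+ 4)) ≡ + s * + s * D
    D-in-ℤ s = trans (pos-* (s ℕ.* s) _)
                     (cong₂ _*_ (pos-* s s) (trans (pos-+ (m ℕ.* p ℕ.* (m ℕ.* p)) 4) (cong (_+ + 4) (pos-* k k))))

    2pa-in-ℤ : ∀ a → + (2 ℕ.* p ℕ.* a) ≡ + 2 * (P * + a)
    2pa-in-ℤ a = trans (pos-* (2 ℕ.* p) a) (trans (cong (_* + a) (pos-* 2 p)) (*-assoc (+ 2) P (+ a)))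

  LeMulSqrt⇒LeSqrt : ∀ {t s} → LeMulSqrt t s (m ℕ.* p ℕ.* (m ℕ.* p) ℕ.+ 4) → LeSqrt t (+ s)
  LeMulSqrt⇒LeSqrt (inj₁ t<0) = le-neg t<0
  LeMulSqrt⇒LeSqrt {t} {s} (inj₂ h) = le-sq (subst (t * t ≤_) (D-in-ℤ s) h)

  LeSqrt⇒LeMulSqrt : ∀ {t s} → LeSqrt t (+ s) → LeMulSqrt t s (m ℕ.* p ℕ.* (m ℕ.* p) ℕ.+ 4)
  LeSqrt⇒LeMulSqrt (le-neg t<0) = inj₁ t<0
  LeSqrt⇒LeMulSqrt {t} {s} (le-sq h) = inj₂ (subst (t * t ≤_) (sym (D-in-ℤ s)) h)

  UnderA⇒floor : ∀ {n a} → UnderA n a → LeMulSqrt (+ (2 ℕ.* p ℕ.* a) - + n * (+ 2 - K)) n (m ℕ.* p ℕ.* (m ℕ.* p) ℕ.+ 4)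
  UnderA⇒floor {n} {a} u = LeSqrt⇒LeMulSqrt (subst (λ z → LeSqrt (z - + n * (+ 2 - K)) (+ n)) (sym (2pa-in-ℤ a)) (conjA⇐ u))

  floor⇒UnderA : ∀ {n a} → LeMulSqrt (+ (2 ℕ.* p ℕ.* a) - + n * (+ 2 - K)) n (m ℕ.* p ℕ.* (m ℕ.* p) ℕ.+ 4) → UnderA n a
  floor⇒UnderA {n} {a} h = conjA⇒ (nonNeg-ℕ n) (den≥0 a) (subst (λ z → LeSqrt (z - + n * (+ 2 - K)) (+ n)) (2pa-in-ℤ a) (LeMulSqrt⇒LeSqrt h))

  UnderB⇒floor : ∀ {n b} → UnderB n b → LeMulSqrt (+ (2 ℕ.* p ℕ.* b) - + n * (+ 2 + K)) n (m ℕ.* p ℕ.* (m ℕ.* p) ℕ.+ 4)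
  UnderB⇒floor {n} {b} u = LeSqrt⇒LeMulSqrt (subst (λ z → LeSqrt (z - + n * (+ 2 + K)) (+ n)) (sym (2pa-in-ℤ b)) (conjB⇐ (nonNeg-ℕ n) u))

  floor⇒UnderB : ∀ {n b} → LeMulSqrt (+ (2 ℕ.* p ℕ.* b) - + n * (+ 2 + K)) n (m ℕ.* p ℕ.* (m ℕ.* p) ℕ.+ 4) → UnderB n b
  floor⇒UnderB {n} {b} h = conjB⇒ (nonNeg-ℕ n) (den≥0 b) (subst (λ z → LeSqrt (z - + n * (+ 2 + K)) (+ n)) (2pa-in-ℤ b) (LeMulSqrt⇒LeSqrt h))

  isA-intro : ∀ {n a} → UnderA n a → ¬ UnderA n (suc a) → IsA m p n a
  isA-intro u ¬u = UnderA⇒floor u , λ h → ¬u (floor⇒UnderA h)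

  isB-intro : ∀ {n b} → UnderB n b → ¬ UnderB n (suc b) → IsB m p n b
  isB-intro u ¬u = UnderB⇒floor u , λ h → ¬u (floor⇒UnderB h)

  private
    cert-shift : ∀ M P W J → + 2 * (P * W) - J * (+ 2 - M * P) ≡ + 2 * (P * (W + M * J)) - J * (+ 2 + M * P)
    cert-shift = solve-∀

  -- b_j = a_j + m j: since (φ + k)/p = φ/p + m, the bound for a_j at w is the
  -- bound for b_j at w + m j.
  shifted-bound : ∀ w j → (+ 2 * (P * + w) - + j * (+ 2 - K)) ≡ (+ 2 * (P * + (w ℕ.+ m ℕ.* j)) - + j * (+ 2 + K))
  shifted-bound w j = begin
    + 2 * (P * + w) - + j * (+ 2 - K)                     ≡⟨ cong (λ K' → + 2 * (P * + w) - + j * (+ 2 - K')) (pos-* m p) ⟩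
    + 2 * (P * + w) - + j * (+ 2 - + m * P)               ≡⟨ cert-shift (+ m) P (+ w) (+ j) ⟩
    + 2 * (P * (+ w + + m * + j)) - + j * (+ 2 + + m * P) ≡⟨ cong₂ (λ z K' → + 2 * (P * z) - + j * (+ 2 + K'))
                                                                  (sym (trans (pos-+ w (m ℕ.* j)) (cong (λ z → + w + z) (pos-* m j))))
                                                                  (sym (pos-* m p)) ⟩
    + 2 * (P * + (w ℕ.+ m ℕ.* j)) - + j * (+ 2 + K)       ∎
    where open ≡-Reasoning

  UnderA⇒UnderB-shift : ∀ {j w} → UnderA j w → UnderB j (w ℕ.+ m ℕ.* j)
  UnderA⇒UnderB-shift {j} {w} u = conjB⇒ (nonNeg-ℕ j) (den≥0 _) (subst (λ c → LeSqrt c (+ j)) (shifted-bound w j) (conjA⇐ u))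

  UnderB⇒UnderA-shift : ∀ {j w} → UnderB j (w ℕ.+ m ℕ.* j) → UnderA j w
  UnderB⇒UnderA-shift {j} {w} u = conjA⇒ (nonNeg-ℕ j) (den≥0 w) (subst (λ c → LeSqrt c (+ j)) (sym (shifted-bound w j)) (conjB⇐ (nonNeg-ℕ j) u))

module LeastWitness where
  open import Data.Nat
  open import Data.Product using (Σ; _×_; _,_)
  open import Relation.Nullary using (¬_; yes; no; Dec)

  least : (Q : ℕ → Set) → (∀ j → Dec (Q j)) → ∀ B → Q B → Σ ℕ (λ T → Q T × (∀ j → j < T → ¬ Q j))
  least Q Q? zero q = 0 , q , λ j ()
  least Q Q? (suc B) q with Q? 0
  ... | yes q₀ = 0 , q₀ , λ j ()
  ... | no ¬q₀ with least (λ j → Q (suc j)) (λ j → Q? (suc j)) B q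
  ...   | T , qT , below = suc T , qT , λ { zero _ → ¬q₀ ; (suc j) (s≤s j<T) → below j j<T }

-- Thresholds.  thrA v is the least j with v ≤ a_j, i.e. the number of j with
-- a_j < v (a is non-decreasing); likewise thrB.  The central fact is the
-- complementarity  thrA v + thrB v = p v + 1  (v ≥ 1): every value w is hit
-- exactly p times by the two sequences together, apart from the double value
-- a_0 = b_0 = 0.
module Thresholds (m p : Data.Nat.ℕ) (m≥1 : 1 Data.Nat.≤ m) (p≥1 : 1 Data.Nat.≤ p) where
  open import Data.Nat
  open import Data.Nat.Properties
  open import Relation.Binary.PropositionalEquality
  open import Data.Product using (Σ; _×_; _,_; proj₁; proj₂)
  open import Data.Empty using (⊥-elim)
  open import Relation.Nullary using (¬_; yes; no)
  open BeattyPair m p m≥1 p≥1 using (UnderA; UnderB; UnderA?; UnderB?; UnderA-mono-j; UnderB-mono-i;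
    UnderA-anti-v; UnderB-anti-v; UnderA-0; UnderB-0; a₀-zero; b₀-zero; UnderA⇒UnderB;
    UnderB⇒¬UnderA-reflect; ¬UnderA⇒UnderB-reflect; UnderA-top)

  abstract
    thrA-spec : ∀ v → Σ ℕ (λ T → UnderA T v × (∀ j → j < T → ¬ UnderA j v))
    thrA-spec v = LeastWitness.least (λ j → UnderA j v) (λ j → UnderA? j v) (p * v) (UnderA-top v)

    thrB-spec : ∀ v → Σ ℕ (λ T → UnderB T v × (∀ j → j < T → ¬ UnderB j v))
    thrB-spec v = LeastWitness.least (λ j → UnderB j v) (λ j → UnderB? j v) (p * v) (UnderA⇒UnderB (UnderA-top v))

  thrA thrB : ℕ → ℕ
  thrA v = proj₁ (thrA-spec v)
  thrB v = proj₁ (thrB-spec v)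

  thrA≤⇒UnderA : ∀ {v j} → thrA v ≤ j → UnderA j v
  thrA≤⇒UnderA {v} le = UnderA-mono-j le (proj₁ (proj₂ (thrA-spec v)))

  UnderA⇒thrA≤ : ∀ {v j} → UnderA j v → thrA v ≤ j
  UnderA⇒thrA≤ {v} {j} u with thrA v ≤? j
  ... | yes le = le
  ... | no ≰ = ⊥-elim (proj₂ (proj₂ (thrA-spec v)) j (≰⇒> ≰) u)

  thrB≤⇒UnderB : ∀ {v j} → thrB v ≤ j → UnderB j v
  thrB≤⇒UnderB {v} le = UnderB-mono-i le (proj₁ (proj₂ (thrB-spec v)))

  UnderB⇒thrB≤ : ∀ {v j} → UnderB j v → thrB v ≤ j
  UnderB⇒thrB≤ {v} {j} u with thrB v ≤? j
  ... | yes le = le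
  ... | no ≰ = ⊥-elim (proj₂ (proj₂ (thrB-spec v)) j (≰⇒> ≰) u)

  thrA-0 : thrA 0 ≡ 0
  thrA-0 = n≤0⇒n≡0 (UnderA⇒thrA≤ (UnderA-0 0))

  thrB-0 : thrB 0 ≡ 0
  thrB-0 = n≤0⇒n≡0 (UnderB⇒thrB≤ (UnderB-0 0))

  thrA≤pv : ∀ v → thrA v ≤ p * v
  thrA≤pv v = UnderA⇒thrA≤ (UnderA-top v)

  thrA-pos : ∀ v → 1 ≤ thrA (suc v)
  thrA-pos v = n≢0⇒n>0 (λ e → a₀-zero v (thrA≤⇒UnderA (≤-reflexive e)))

  thrB≤thrA : ∀ v → thrB v ≤ thrA v
  thrB≤thrA v = UnderB⇒thrB≤ (UnderA⇒UnderB (thrA≤⇒UnderA ≤-refl))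

  thrA-mono : ∀ {v v'} → v ≤ v' → thrA v ≤ thrA v'
  thrA-mono le = UnderA⇒thrA≤ (UnderA-anti-v le (thrA≤⇒UnderA ≤-refl))

  thrB-mono : ∀ {v v'} → v ≤ v' → thrB v ≤ thrB v'
  thrB-mono le = UnderB⇒thrB≤ (UnderB-anti-v le (thrB≤⇒UnderB ≤-refl))

  -- Complementarity, from the reflection  v ≤ b_i ⟺ ¬ (v ≤ a_{pv-i}):
  -- the least such i is  p v + 1 - thrA v.
  complementarity : ∀ v → thrA (suc v) + thrB (suc v) ≡ suc (p * suc v)
  complementarity v = trans (cong (thrA (suc v) +_) thrB≡) (m+[n∸m]≡n (m≤n⇒m≤1+n (thrA≤pv (suc v))))
    where
    V = p * suc v
    thrB-from : ∀ T → 1 ≤ T → T ≤ V → UnderA T (suc v) → (∀ j → j < T → ¬ UnderA j (suc v)) → thrB (suc v) ≡ suc V ∸ T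
    thrB-from (suc T) (s≤s z≤n) T<V uT below = ≤-antisym (UnderB⇒thrB≤ at) above
      where
      at : UnderB (V ∸ T) (suc v)
      at = ¬UnderA⇒UnderB-reflect (m∸n≤m V T)
             (subst (λ j → ¬ UnderA j (suc v)) (sym (m∸[m∸n]≡n (≤-trans (n≤1+n T) T<V))) (below T ≤-refl))
      ¬before : ¬ UnderB (V ∸ suc T) (suc v)
      ¬before u = UnderB⇒¬UnderA-reflect (m∸n≤m V (suc T)) u (subst (λ j → UnderA j (suc v)) (sym (m∸[m∸n]≡n T<V)) uT)
      above : V ∸ T ≤ thrB (suc v)
      above with thrB (suc v) ≤? V ∸ suc T
      ... | yes le = ⊥-elim (¬before (thrB≤⇒UnderB le))
      ... | no ≰ = subst (_≤ thrB (suc v)) (sym (+-∸-assoc 1 T<V)) (≰⇒> ≰)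
    thrB≡ : thrB (suc v) ≡ suc V ∸ thrA (suc v)
    thrB≡ = thrB-from (thrA (suc v)) (thrA-pos v) (thrA≤pv (suc v)) (thrA≤⇒UnderA ≤-refl)
              (λ j j<T u → <⇒≱ j<T (UnderA⇒thrA≤ u))

  -- Each value is taken at most p times by a:  thrA (w+1) ≤ thrA w + p.
  thrA-gap : ∀ w → thrA (suc w) ≤ thrA w + p
  thrA-gap w = +-cancelʳ-≤ (thrB (suc w)) _ _ (begin
    thrA (suc w) + thrB (suc w)    ≡⟨ complementarity w ⟩
    suc (p * suc w)                ≡⟨ cong suc (*-suc p w) ⟩
    suc (p + p * w)                ≡⟨ cong suc (+-comm p (p * w)) ⟩
    suc (p * w) + p                ≤⟨ +-monoˡ-≤ p (earlier w) ⟩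
    thrA w + thrB (suc w) + p      ≡⟨ +-assoc (thrA w) _ p ⟩
    thrA w + (thrB (suc w) + p)    ≡⟨ cong (thrA w +_) (+-comm (thrB (suc w)) p) ⟩
    thrA w + (p + thrB (suc w))    ≡⟨ sym (+-assoc (thrA w) p _) ⟩
    thrA w + p + thrB (suc w)      ∎)
    where
    open ≤-Reasoning
    -- p w + 1 ≤ thrA w + thrB (w+1): complementarity at w, or thrB 1 ≥ 1 when w = 0.
    earlier : ∀ w → suc (p * w) ≤ thrA w + thrB (suc w)
    earlier zero rewrite thrA-0 | *-zeroʳ p = n≢0⇒n>0 (λ e → b₀-zero 0 (thrB≤⇒UnderB (≤-reflexive e)))
    earlier (suc w) = ≤-trans (≤-reflexive (sym (complementarity w))) (+-monoʳ-≤ (thrA (suc w)) (thrB-mono (n≤1+n (suc w))))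

module Floors (m p : Data.Nat.ℕ) (m≥1 : 1 Data.Nat.≤ m) (p≥1 : 1 Data.Nat.≤ p) where
  open import Data.Nat
  open import Data.Nat.Properties
  open import Data.Nat.Tactic.RingSolver using (solve-∀)
  open import Relation.Binary.PropositionalEquality
  open import Data.Product using (Σ; _×_; _,_)
  open import Data.Empty using (⊥-elim)
  open import Relation.Nullary using (¬_; yes; no; ¬?)
  open import Relation.Nullary.Decidable using (decidable-stable)
  open BeattyPair m p m≥1 p≥1 using (k; UnderA; UnderB; UnderA?; UnderA-anti-v; UnderB-anti-v; UnderA-0; UnderA-growth)
  open FloorForms m p m≥1 p≥1 using (UnderA⇒UnderB-shift; UnderB⇒UnderA-shift)
  open Thresholds m p m≥1 p≥1 public

  -- "a = a_n" and "b = b_n" in terms of the order relations.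
  FloorA FloorB : ℕ → ℕ → Set
  FloorA n a = UnderA n a × ¬ UnderA n (suc a)
  FloorB n b = UnderB n b × ¬ UnderB n (suc b)

  FloorA-thr≤ : ∀ {n a v} → FloorA n a → v ≤ a → thrA v ≤ n
  FloorA-thr≤ (u , _) v≤a = UnderA⇒thrA≤ (UnderA-anti-v v≤a u)

  thr≤-FloorA : ∀ {n a v} → FloorA n a → thrA v ≤ n → v ≤ a
  thr≤-FloorA {n} {a} {v} (_ , ¬u) le with v ≤? a
  ... | yes v≤a = v≤a
  ... | no v≰a = ⊥-elim (¬u (UnderA-anti-v (≰⇒> v≰a) (thrA≤⇒UnderA le)))

  FloorB-thr≤ : ∀ {n b v} → FloorB n b → v ≤ b → thrB v ≤ n
  FloorB-thr≤ (u , _) v≤b = UnderB⇒thrB≤ (UnderB-anti-v v≤b u)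

  thr≤-FloorB : ∀ {n b v} → FloorB n b → thrB v ≤ n → v ≤ b
  thr≤-FloorB {n} {b} {v} (_ , ¬u) le with v ≤? b
  ... | yes v≤b = v≤b
  ... | no v≰b = ⊥-elim (¬u (UnderB-anti-v (≰⇒> v≰b) (thrB≤⇒UnderB le)))

  FloorA-lower : ∀ {n a} → FloorA n a → thrA a ≤ n
  FloorA-lower f = FloorA-thr≤ f ≤-refl

  FloorA-upper : ∀ {n a} → FloorA n a → n < thrA (suc a)
  FloorA-upper {n} {a} f = ≰⇒> (λ le → 1+n≰n (thr≤-FloorA f le))

  thr-FloorA : ∀ {n a} → thrA a ≤ n → n < thrA (suc a) → FloorA n a
  thr-FloorA lo hi = thrA≤⇒UnderA lo , λ u → <⇒≱ hi (UnderA⇒thrA≤ u)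

  FloorB-lower : ∀ {n b} → FloorB n b → thrB b ≤ n
  FloorB-lower f = FloorB-thr≤ f ≤-refl

  FloorB-upper : ∀ {n b} → FloorB n b → n < thrB (suc b)
  FloorB-upper {n} {b} f = ≰⇒> (λ le → 1+n≰n (thr≤-FloorB f le))

  thr-FloorB : ∀ {n b} → thrB b ≤ n → n < thrB (suc b) → FloorB n b
  thr-FloorB lo hi = thrB≤⇒UnderB lo , λ u → <⇒≱ hi (UnderB⇒thrB≤ u)

  FloorA-unique : ∀ {n a a'} → FloorA n a → FloorA n a' → a ≡ a'
  FloorA-unique f f' = ≤-antisym (thr≤-FloorA f' (FloorA-lower f)) (thr≤-FloorA f (FloorA-lower f'))

  FloorB-unique : ∀ {n b b'} → FloorB n b → FloorB n b' → b ≡ b'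
  FloorB-unique g g' = ≤-antisym (thr≤-FloorB g' (FloorB-lower g)) (thr≤-FloorB g (FloorB-lower g'))

  FloorA⇒FloorB : ∀ {n a} → FloorA n a → FloorB n (a + m * n)
  FloorA⇒FloorB (u , ¬u) = UnderA⇒UnderB-shift u , λ u' → ¬u (UnderB⇒UnderA-shift u')

  -- a_n < 2n + 1, from the growth bound:  k p (2n+1) < (k+1) n ≤ 2 k n  is absurd.
  ¬UnderA-2n+1 : ∀ n → ¬ UnderA n (suc (2 * n))
  ¬UnderA-2n+1 n u = <⇒≱ p[2n+1]<2n (≤-trans (n≤1+n (2 * n)) 2n+1≤p[2n+1])
    where
    2n+1≤p[2n+1] : suc (2 * n) ≤ p * suc (2 * n)
    2n+1≤p[2n+1] = subst (_≤ p * suc (2 * n)) (*-identityˡ _) (*-monoˡ-≤ (suc (2 * n)) p≥1)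
    p[2n+1]<2n : p * suc (2 * n) < 2 * n
    p[2n+1]<2n = *-cancelˡ-< k _ _ (begin-strict
      k * (p * suc (2 * n))  <⟨ UnderA-growth u ⟩
      (k + 1) * n            ≤⟨ *-monoˡ-≤ n (+-monoʳ-≤ k (*-mono-≤ m≥1 p≥1)) ⟩
      (k + k) * n            ≡⟨ double k n ⟩
      k * (2 * n)            ∎)
      where open ≤-Reasoning
            double : ∀ k n → (k + k) * n ≡ k * (2 * n)
            double = solve-∀

  -- a_n exists: the least v with ¬ (v ≤ a_n) is a_n + 1.
  abstract
    FloorA-exists : ∀ n → Σ ℕ (FloorA n)
    FloorA-exists n = from-least (LeastWitness.least (λ v → ¬ UnderA n v) (λ v → ¬? (UnderA? n v)) (suc (2 * n)) (¬UnderA-2n+1 n))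
      where
      from-least : Σ ℕ (λ v → ¬ UnderA n v × (∀ j → j < v → ¬ ¬ UnderA n j)) → Σ ℕ (FloorA n)
      from-least (zero  , ¬u₀ , _)     = ⊥-elim (¬u₀ (UnderA-0 n))
      from-least (suc a , ¬u , below) = a , decidable-stable (UnderA? n a) (below a ≤-refl) , ¬u

module Recurrence (m p : Data.Nat.ℕ) (m≥1 : 1 Data.Nat.≤ m) (p≥1 : 1 Data.Nat.≤ p) where
  open import Data.Nat
  open import Data.Nat.Properties
  open import Data.Nat.DivMod
  open import Data.Nat.Tactic.RingSolver using (solve-∀)
  open import Relation.Binary.PropositionalEquality
  open import Data.Sum using (_⊎_; inj₁; inj₂)
  open import Data.Product using (Σ; _×_; _,_)
  open import Data.Empty using (⊥)
  open import Relation.Nullary using (yes; no)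
  open Floors m p m≥1 p≥1

  instance
    p-nonZero : NonZero p
    p-nonZero = >-nonZero p≥1

  -- The indices with a_i = a lie in [thrA a, thrA (a+1)), an interval of length ≤ p.
  a-repeats : ∀ {i n a} → FloorA i a → FloorA n a → i + p ≤ n → ⊥
  a-repeats {i} {n} {a} fi fn i+p≤n =
    <⇒≱ (FloorA-upper fn) (≤-trans (thrA-gap a) (≤-trans (+-monoˡ-≤ p (FloorA-lower fi)) i+p≤n))

  no-multiple-between : ∀ {w x r} → p * w < x → x < p * suc w → x ≡ p * r → ⊥
  no-multiple-between {w} {x} {r} lo hi refl = <⇒≱ (*-cancelˡ-< p r (suc w) hi) (*-cancelˡ-< p w r lo)

  -- If a_n = b_i = w with i < n, then p w < n + i < p (w+1): the lower bound by
  -- complementarity at w (or i < n when w = 0), the upper one by complementarity at w+1.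
  clash-lower : ∀ {i n} w → FloorB i w → FloorA n w → i < n → p * w < n + i
  clash-lower {i} {n} zero    gi fn i<n = subst (_< n + i) (sym (*-zeroʳ p)) (≤-trans (≤-trans (s≤s z≤n) i<n) (m≤m+n n i))
  clash-lower {i} {n} (suc w) gi fn i<n = subst (_≤ n + i) (complementarity w) (+-mono-≤ (FloorA-lower fn) (FloorB-lower gi))

  clash-upper : ∀ {i n w} → FloorB i w → FloorA n w → n + i < p * suc w
  clash-upper {i} {n} {w} gi fn = s<s⁻¹ (subst (suc (n + i) <_) (complementarity w) sum<)
    where
    sum< : suc (n + i) < thrA (suc w) + thrB (suc w)
    sum< = subst (_≤ thrA (suc w) + thrB (suc w)) (cong suc (+-suc n i)) (+-mono-≤ (FloorA-upper fn) (FloorB-upper gi))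

  b-no-clash : ∀ {i n w r} → FloorB i w → FloorA n w → i < n → n + i ≡ p * r → ⊥
  b-no-clash {w = w} gi fn i<n = no-multiple-between (clash-lower w gi fn i<n) (clash-upper gi fn)

  -- w occurs earlier "in the right residue class": as a_i with n ≡ i (mod p),
  -- or as b_i with i < n and n ≡ -i (mod p).
  Cover : ℕ → ℕ → Set
  Cover n w = (Σ ℕ λ i → Σ ℕ λ q → (n ≡ i + p * suc q) × FloorA i w)
            ⊎ (Σ ℕ λ i → Σ ℕ λ r → (i < n) × (n + i ≡ p * r) × FloorB i w)

  divide-above : ∀ n Y → Y ≤ n → Σ ℕ λ j → Σ ℕ λ q → (Y ≤ j) × (j < Y + p) × (n ≡ j + p * q)
  divide-above n Y Y≤n = Y + d % p , d / p , m≤m+n Y (d % p) , +-monoʳ-< Y (m%n<n d p) , e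
    where
    d = n ∸ Y
    e : n ≡ Y + d % p + p * (d / p)
    e = begin
      n                        ≡⟨ sym (m+[n∸m]≡n Y≤n) ⟩
      Y + d                    ≡⟨ cong (Y +_) (m≡m%n+[m/n]*n d p) ⟩
      Y + (d % p + d / p * p)  ≡⟨ regroup Y (d % p) (d / p) p ⟩
      Y + d % p + p * (d / p)  ∎
      where open ≡-Reasoning
            regroup : ∀ a b c p → a + (b + c * p) ≡ a + b + p * c
            regroup = solve-∀

  private
    shift-suc : ∀ p i q → p + i + p * q ≡ i + p * suc q
    shift-suc = solve-∀
    *-suc' : ∀ p w → p * w + p ≡ p * suc w
    *-suc' = solve-∀
    swap : ∀ j q i → j + q + i ≡ (j + i) + q
    swap = solve-∀
    collect : ∀ p sw q → p * sw + p * q ≡ p * (q + sw)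
    collect = solve-∀

  -- In the b-case the reflected index i = p (w+1) - j satisfies b_i ≥ w.
  reflected-above : ∀ w j i → suc j ≤ thrA w + p → j + i ≡ p * suc w → thrB w ≤ i
  reflected-above zero     j i _ _ = subst (_≤ i) (sym thrB-0) z≤n
  reflected-above (suc w) j i j<X+p j+i≡ = +-cancelʳ-≤ j (thrB (suc w)) i (s≤s⁻¹ (begin-strict
    thrB (suc w) + j                      <⟨ +-monoʳ-< (thrB (suc w)) j<X+p ⟩
    thrB (suc w) + (thrA (suc w) + p)     ≡⟨ sym (+-assoc (thrB (suc w)) (thrA (suc w)) p) ⟩
    thrB (suc w) + thrA (suc w) + p       ≡⟨ cong (_+ p) (trans (+-comm (thrB (suc w)) (thrA (suc w))) (complementarity w)) ⟩
    suc (p * suc w) + p                   ≡⟨ cong suc (*-suc' p (suc w)) ⟩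
    suc (p * suc (suc w))                 ≡⟨ cong suc (trans (sym j+i≡) (+-comm j i)) ⟩
    suc (i + j)                           ∎))
    where open ≤-Reasoning

  -- The indices i with a_i = w form [X, Y) with X = thrA w, Y = thrA (w+1) ≤ n.
  -- Write n = j + p q with Y ≤ j < Y + p.  If j ≥ X + p then i = j - p ∈ [X, Y) has
  -- a_i = w; otherwise i = p (w+1) - j has b_i = w (by complementarity) and p ∣ n + i.
  covering : ∀ {n a w} → FloorA n a → w < a → Cover n w
  covering {n} {a} {w} fn w<a with divide-above n (thrA (suc w)) (FloorA-thr≤ fn w<a)
  ... | j , q , Y≤j , j<Y+p , n≡ with thrA w + p ≤? j
  ...   | yes X+p≤j = inj₁ (i , q , n≡i+p[q+1] , thr-FloorA X≤i i<Y)
    where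
    X = thrA w
    Y = thrA (suc w)
    i = j ∸ p
    p+i≡j : p + i ≡ j
    p+i≡j = m+[n∸m]≡n (≤-trans (m≤n+m p X) X+p≤j)
    X≤i : X ≤ i
    X≤i = +-cancelˡ-≤ p X i (subst (p + X ≤_) (sym p+i≡j) (subst (_≤ j) (+-comm X p) X+p≤j))
    i<Y : i < Y
    i<Y = +-cancelˡ-< p i Y (subst (_< p + Y) (sym p+i≡j) (subst (j <_) (+-comm Y p) j<Y+p))
    n≡i+p[q+1] : n ≡ i + p * suc q
    n≡i+p[q+1] = trans n≡ (trans (cong (_+ p * q) (sym p+i≡j)) (shift-suc p i q))
  ...   | no X+p≰j = inj₂ (i , q + suc w , i<n , n+i≡ , thr-FloorB (reflected-above w j i j<X+p j+i≡) i<thrB)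
    where
    X = thrA w
    Y = thrA (suc w)
    j<X+p : suc j ≤ X + p
    j<X+p = ≰⇒> X+p≰j
    j≤p[w+1] : j ≤ p * suc w
    j≤p[w+1] = ≤-trans (n≤1+n j) (≤-trans j<X+p (subst (X + p ≤_) (*-suc' p w) (+-monoˡ-≤ p (thrA≤pv w))))
    i = p * suc w ∸ j
    j+i≡ : j + i ≡ p * suc w
    j+i≡ = m+[n∸m]≡n j≤p[w+1]
    i<thrB : i < thrB (suc w)
    i<thrB = +-cancelˡ-≤ Y (suc i) (thrB (suc w))
               (subst (Y + suc i ≤_) (sym (complementarity w))
                 (subst (_≤ suc (p * suc w)) (sym (+-suc Y i)) (s≤s (subst (Y + i ≤_) j+i≡ (+-monoˡ-≤ i Y≤j)))))
    i<n : i < n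
    i<n = <-≤-trans i<thrB (≤-trans (thrB≤thrA (suc w)) (FloorA-thr≤ fn w<a))
    n+i≡ : n + i ≡ p * (q + suc w)
    n+i≡ = trans (cong (_+ i) n≡) (trans (swap j (p * q) i) (trans (cong (_+ p * q) j+i≡) (collect p (suc w) q)))

  a-index-< : ∀ {i n q} → n ≡ i + p * suc q → i < n
  a-index-< {i} {n} {q} refl = m<m+n i (≤-trans p≥1 (m≤m*n p (suc q)))

  a-index-+p≤ : ∀ {i n q} → n ≡ i + p * suc q → i + p ≤ n
  a-index-+p≤ {i} {n} {q} refl = +-monoʳ-≤ i (m≤m*n p (suc q))

module MexUniqueness where
  open import Data.Nat
  open import Data.Nat.Properties using (<-cmp; <⇒≱)
  open import Data.Empty using (⊥-elim)
  open import Data.Product using (_,_)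
  open import Relation.Binary.PropositionalEquality using (_≡_)
  open import Relation.Binary.Definitions using (tri<; tri≈; tri>)
  open import Defs using (IsMex; IsMexP)

  mex-unique : ∀ {P : ℕ → Set} {v v'} → IsMex P v → IsMex P v' → v ≡ v'
  mex-unique (v∉ , below) (v'∉ , below') with <-cmp _ _
  ... | tri< v<v' _ _ = ⊥-elim (v∉ (below' _ v<v'))
  ... | tri≈ _ e _    = e
  ... | tri> _ _ v'<v = ⊥-elim (v'∉ (below _ v'<v))

  mexP-unique : ∀ {p} {ξ : ℕ → ℕ} {v v'} → IsMexP p ξ v → IsMexP p ξ v' → v ≡ v'
  mexP-unique (v< , below) (v'< , below') with <-cmp _ _
  ... | tri< v<v' _ _ = ⊥-elim (<⇒≱ v< (below' _ v<v'))
  ... | tri≈ _ e _    = e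
  ... | tri> _ _ v'<v = ⊥-elim (<⇒≱ v'< (below _ v'<v))

module Congruences (p : Data.Nat.ℕ) where
  open import Data.Nat
  open import Data.Nat.Properties
  import Data.Integer as ℤ
  import Data.Integer.Properties as ℤP
  open import Data.Nat.Divisibility using (divides)
  open import Relation.Binary.PropositionalEquality
  open import Data.Product using (Σ; _,_)
  open import Data.Empty using (⊥-elim)
  open import Defs using (_≡_[mod_])

  ∣+a-+b∣ : ∀ {a b} → b ≤ a → ℤ.∣ ℤ.+ a ℤ.- ℤ.+ b ∣ ≡ a ∸ b
  ∣+a-+b∣ {a} {b} b≤a = cong ℤ.∣_∣ (trans (ℤP.[+m]-[+n]≡m⊖n a b) (ℤP.⊖-≥ b≤a))

  ∣+a+b∣ : ∀ a b → ℤ.∣ ℤ.+ a ℤ.- ℤ.- (ℤ.+ b) ∣ ≡ a + b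
  ∣+a+b∣ a b = cong ℤ.∣_∣ (trans (cong (λ z → ℤ.+ a ℤ.+ z) (ℤP.neg-involutive (ℤ.+ b))) (sym (ℤP.pos-+ a b)))

  ≡[mod]⇒step : ∀ {i n} → i < n → (ℤ.+ n) ≡ (ℤ.+ i) [mod p ] → Σ ℕ λ q → n ≡ i + p * suc q
  ≡[mod]⇒step {i} {n} i<n (divides zero e) =
    ⊥-elim (<⇒≢ (m<n⇒0<n∸m i<n) (sym (trans (sym (∣+a-+b∣ (<⇒≤ i<n))) e)))
  ≡[mod]⇒step {i} {n} i<n (divides (suc q) e) =
    q , trans (sym (m+[n∸m]≡n (<⇒≤ i<n))) (cong (i +_) (trans (trans (sym (∣+a-+b∣ (<⇒≤ i<n))) e) (*-comm (suc q) p)))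

  step⇒≡[mod] : ∀ {i n q} → n ≡ i + p * q → (ℤ.+ n) ≡ (ℤ.+ i) [mod p ]
  step⇒≡[mod] {i} {n} {q} refl = divides q (trans (∣+a-+b∣ (m≤m+n i (p * q))) (trans (m+n∸m≡n i (p * q)) (*-comm p q)))

  ≡-[mod]⇒multiple : ∀ {i n} → (ℤ.+ n) ≡ ℤ.- (ℤ.+ i) [mod p ] → Σ ℕ λ r → n + i ≡ p * r
  ≡-[mod]⇒multiple {i} {n} (divides r e) = r , trans (sym (∣+a+b∣ n i)) (trans e (*-comm r p))

  multiple⇒≡-[mod] : ∀ {i n r} → n + i ≡ p * r → (ℤ.+ n) ≡ ℤ.- (ℤ.+ i) [mod p ]
  multiple⇒≡-[mod] {i} {n} {r} e = divides r (trans (∣+a+b∣ n i) (trans e (*-comm p r)))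

module FloorInduction (m p : Data.Nat.ℕ) (m≥1 : 1 Data.Nat.≤ m) (p≥1 : 1 Data.Nat.≤ p) where
  open import Data.Nat
  open import Data.Nat.Induction using (<-rec)
  open import Relation.Binary.PropositionalEquality
  open import Data.Product using (_,_)
  open Floors m p m≥1 p≥1

  floor-induction : (x : ℕ → ℕ) →
    (∀ n → (∀ i → i < n → FloorA i (x i)) → ∀ {a} → FloorA n a → x n ≡ a) →
    ∀ n → FloorA n (x n)
  floor-induction x step = <-rec _ λ n earlier →
    let (a , fa) = FloorA-exists n in subst (FloorA n) (sym (step n (λ i i<n → earlier i<n) fa)) fa

  companion-floor : ∀ {i a b} → b ≡ a + m * i → FloorA i a → FloorB i b
  companion-floor y≡ fa = subst (FloorB _) (sym y≡) (FloorA⇒FloorB fa)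

-- Definition (ii): x_n = mex { x_i : i < n, n ≡ i } ∪ { y_i : i < n, n ≡ -i } (mod p).
-- At a = a_n, a-repeats and b-no-clash show a is not in the set, and covering
-- shows every smaller value is.
module DefinitionII (m p : Data.Nat.ℕ) (m≥1 : 1 Data.Nat.≤ m) (p≥1 : 1 Data.Nat.≤ p) where
  open import Data.Nat
  open import Relation.Binary.PropositionalEquality
  open import Data.Sum using (inj₁; inj₂)
  open import Data.Product using (_,_; proj₁; proj₂)
  open import Relation.Nullary using (¬_)
  open import Defs using (DefII; MexSetII)
  open Floors m p m≥1 p≥1
  open Recurrence m p m≥1 p≥1
  open Congruences p
  open FloorInduction m p m≥1 p≥1
  open MexUniqueness

  floorsII : ∀ x y → DefII m p x y → ∀ n → FloorA n (x n)
  floorsII x y def = floor-induction x step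
    where
    step : ∀ n → (∀ i → i < n → FloorA i (x i)) → ∀ {a} → FloorA n a → x n ≡ a
    step n earlier {a} fa = mex-unique (proj₁ (def n)) (a∉ , below∈)
      where
      earlierB : ∀ i → i < n → FloorB i (y i)
      earlierB i i<n = companion-floor (proj₂ (def i)) (earlier i i<n)
      a∉ : ¬ MexSetII p x y n a
      a∉ (i , i<n , inj₁ (n≡i , a≡xi)) with ≡[mod]⇒step i<n n≡i
      ... | q , n≡ = a-repeats (subst (FloorA i) (sym a≡xi) (earlier i i<n)) fa (a-index-+p≤ n≡)
      a∉ (i , i<n , inj₂ (n≡-i , a≡yi)) with ≡-[mod]⇒multiple {i} {n} n≡-i
      ... | r , n+i≡ = b-no-clash (subst (FloorB i) (sym a≡yi) (earlierB i i<n)) fa i<n n+i≡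
      below∈ : ∀ w → w < a → MexSetII p x y n w
      below∈ w w<a with covering fa w<a
      ... | inj₁ (i , q , n≡ , fiw) =
              i , a-index-< n≡ , inj₁ (step⇒≡[mod] n≡ , FloorA-unique fiw (earlier i (a-index-< n≡)))
      ... | inj₂ (i , r , i<n , n+i≡ , giw) =
              i , i<n , inj₂ (multiple⇒≡-[mod] {i} {n} n+i≡ , FloorB-unique giw (earlierB i i<n))

-- The index sets of (iii) are those of (ii) rewritten per class: for l = 0 the
-- indices i < p n with i ≡ ±N (mod p) are the p i', i' < n; for 0 < l < p the
-- indices ≡ N are p i' + l, and those ≡ -N are p (i'+1) - l with i' < n, plus
-- the single index p (n+1) - l, which never matters (b-beyond).
module DefinitionIII (m p : Data.Nat.ℕ) (m≥1 : 1 Data.Nat.≤ m) (p≥1 : 1 Data.Nat.≤ p) where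
  open import Data.Nat
  open import Data.Nat.Properties
  open import Data.Nat.DivMod
  open import Data.Nat.Tactic.RingSolver using (solve-∀)
  open import Relation.Binary.PropositionalEquality
  open import Data.Sum using (_⊎_; inj₁; inj₂)
  open import Data.Product using (Σ; _×_; _,_; proj₁; proj₂)
  open import Data.Empty using (⊥; ⊥-elim)
  open import Relation.Nullary using (¬_)
  open import Defs using (DefIII; MexSet0; MexSetL)
  open BeattyPair m p m≥1 p≥1 using (k; UnderA-growth)
  open Floors m p m≥1 p≥1
  open Recurrence m p m≥1 p≥1
  open FloorInduction m p m≥1 p≥1
  open MexUniqueness

  residue-split : ∀ N → (Σ ℕ λ n → N ≡ p * n) ⊎ (Σ ℕ λ n → Σ ℕ λ l → 0 < l × l < p × N ≡ p * n + l)
  residue-split N with N % p in e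
  ... | zero  = inj₁ (N / p , trans (m≡m%n+[m/n]*n N p) (trans (cong (_+ (N / p) * p) e) (*-comm (N / p) p)))
  ... | suc l = inj₂ (N / p , suc l , s≤s z≤n , subst (_< p) e (m%n<n N p) ,
                  trans (m≡m%n+[m/n]*n N p) (trans (cong (_+ (N / p) * p) e)
                        (trans (+-comm (suc l) _) (cong (_+ suc l) (*-comm (N / p) p)))))

  companionIII : ∀ x y → DefIII m p x y → ∀ N → y N ≡ x N + m * N
  companionIII x y (def₀ , defₗ) N with residue-split N
  ... | inj₁ (n , refl) = proj₂ (def₀ n)
  ... | inj₂ (n , l , 0<l , l<p , refl) = proj₂ (defₗ n l 0<l l<p)

  private
    split-a₀ : ∀ p q i' → p * (q + i') ≡ p * i' + p * q
    split-a₀ = solve-∀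
    split-b₀ : ∀ p n i' → p * (n + i') ≡ p * n + p * i'
    split-b₀ = solve-∀
    split-aₗ : ∀ p q i' l → p * (q + i') + l ≡ (p * i' + l) + p * q
    split-aₗ = solve-∀
    regroup : ∀ p n l i → p * n + l + i ≡ p * n + (l + i)
    regroup = solve-∀
    split-bₗ : ∀ p n t → p * (suc n + t) ≡ p * n + p * suc t
    split-bₗ = solve-∀
    bound-bₗ : ∀ p n → p + (p * n + p) ≡ p * suc (suc n)
    bound-bₗ = solve-∀

  a-index₀ : ∀ {n i q} → p * n ≡ i + p * suc q → Σ ℕ λ i' → i' < n × i ≡ p * i'
  a-index₀ {n} {i} {q} e with m≤n⇒∃[o]m+o≡n (*-cancelˡ-≤ p (subst (p * suc q ≤_) (sym e) (m≤n+m (p * suc q) i)))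
  ... | i' , q+i'≡n = i' , subst (i' <_) q+i'≡n (m<n+m i' (s≤s z≤n)) ,
     +-cancelʳ-≡ (p * suc q) i (p * i') (trans (sym e) (trans (cong (p *_) (sym q+i'≡n)) (split-a₀ p (suc q) i')))

  b-index₀ : ∀ {n i r} → i < p * n → p * n + i ≡ p * r → Σ ℕ λ i' → i' < n × i ≡ p * i'
  b-index₀ {n} {i} {r} i<pn e with m≤n⇒∃[o]m+o≡n (*-cancelˡ-≤ p (subst (p * n ≤_) e (m≤m+n (p * n) i)))
  ... | i' , n+i'≡r = i' , *-cancelˡ-< p i' n (subst (_< p * n) i≡ i<pn) , i≡
    where
    i≡ : i ≡ p * i'
    i≡ = +-cancelˡ-≡ (p * n) i (p * i') (trans e (trans (cong (p *_) (sym n+i'≡r)) (split-b₀ p n i')))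

  a-indexₗ : ∀ {n l i q} → l < p → p * n + l ≡ i + p * suc q → Σ ℕ λ i' → i' < n × i ≡ p * i' + l
  a-indexₗ {n} {l} {i} {q} l<p e with m≤n⇒∃[o]m+o≡n q<n
    where
    q<n : suc q ≤ n
    q<n = s≤s⁻¹ (*-cancelˡ-< p (suc q) (suc n)
            (≤-<-trans (subst (p * suc q ≤_) (sym e) (m≤n+m (p * suc q) i))
               (subst₂ _<_ (+-comm l (p * n)) (sym (*-suc p n)) (+-monoˡ-< (p * n) l<p))))
  ... | i' , q+i'≡n = i' , subst (i' <_) q+i'≡n (m<n+m i' (s≤s z≤n)) ,
     +-cancelʳ-≡ (p * suc q) i (p * i' + l) (trans (sym e) (trans (cong (λ z → p * z + l) (sym q+i'≡n)) (split-aₗ p (suc q) i' l)))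

  b-indexₗ : ∀ {n l i r} → 0 < l → l < p → i < p * n + l → p * n + l + i ≡ p * r →
             Σ ℕ λ t → t ≤ n × l + i ≡ p * suc t
  b-indexₗ {n} {l} {i} {r} 0<l l<p i<N e
    with m≤n⇒∃[o]m+o≡n (*-cancelˡ-< p n r (subst (p * n <_) e (≤-trans (m<m+n (p * n) 0<l) (m≤m+n (p * n + l) i))))
  ... | t , n+t≡r = t , t≤n , l+i≡
    where
    l+i≡ : l + i ≡ p * suc t
    l+i≡ = +-cancelˡ-≡ (p * n) (l + i) (p * suc t)
             (trans (sym (regroup p n l i)) (trans e (trans (cong (p *_) (sym n+t≡r)) (split-bₗ p n t))))
    t≤n : t ≤ n
    t≤n = s≤s⁻¹ (s≤s⁻¹ (*-cancelˡ-< p (suc t) (suc (suc n))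
           (subst (_< p * suc (suc n)) l+i≡
             (<-trans (+-monoʳ-< l i<N) (subst (l + (p * n + l) <_) (bound-bₗ p n) (+-mono-< l<p (+-monoʳ-< (p * n) l<p)))))))

  private
    distrib : ∀ k i Y → k * (i + Y) ≡ k * i + k * Y
    distrib = solve-∀
    suc-* : ∀ k Y → (k + 1) * Y ≡ Y + k * Y
    suc-* = solve-∀

  +-below-* : ∀ {q i l} → 1 ≤ i → l < q → i + l ≤ q * i
  +-below-* {suc q} {suc i} {l} _ l<q = +-monoʳ-≤ (suc i) (≤-trans (s≤s⁻¹ l<q) (m≤m*n q (suc i)))

  -- The extra index i = p (n+1) - l never carries a value below a_N: if b_i = w < a_N,
  --   N < i + l ≤ p i ≤ k i < thrA (w+1) ≤ N,
  -- where k i < thrA (w+1) combines complementarity with the growth bound.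
  b-beyond : ∀ {n l i w N a} → FloorB i w → FloorA N a → w < a → i + l ≡ p * suc n → N ≡ p * n + l → l < p → ⊥
  b-beyond {n} {l} {i} {w} {N} {a} gi fa w<a i+l≡ N≡ l<p = <-irrefl refl (begin-strict
    N      <⟨ N<i+l ⟩
    i + l  ≤⟨ i+l≤pi ⟩
    p * i  ≤⟨ *-monoˡ-≤ i p≤k ⟩
    k * i  <⟨ ki<Y ⟩
    Y      ≤⟨ FloorA-thr≤ fa w<a ⟩
    N      ∎)
    where
    open ≤-Reasoning
    Y = thrA (suc w)
    N<i+l : N < i + l
    N<i+l = subst₂ _<_ (trans (+-comm l (p * n)) (sym N≡)) (trans (sym (*-suc p n)) (sym i+l≡)) (+-monoˡ-< (p * n) l<p)
    i≥1 : 1 ≤ i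
    i≥1 = n≢0⇒n>0 (λ i≡0 → <⇒≱ l<p (subst (p ≤_) (trans (sym i+l≡) (cong (_+ l) i≡0)) (m≤m*n p (suc n))))
    i+l≤pi : i + l ≤ p * i
    i+l≤pi = +-below-* i≥1 l<p
    p≤k : p ≤ k
    p≤k = subst (_≤ m * p) (*-identityˡ p) (*-monoˡ-≤ p m≥1)
    i+Y≤p[w+1] : i + Y ≤ p * suc w
    i+Y≤p[w+1] = s≤s⁻¹ (subst (suc i + Y ≤_) (trans (+-comm (thrB (suc w)) Y) (complementarity w)) (+-monoˡ-≤ Y (FloorB-upper gi)))
    ki<Y : k * i < Y
    ki<Y = +-cancelʳ-< (k * Y) (k * i) Y
             (subst₂ _<_ (distrib k i Y) (suc-* k Y) (≤-<-trans (*-monoʳ-≤ k i+Y≤p[w+1]) (UnderA-growth (thrA≤⇒UnderA ≤-refl))))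

  private
    p[i+1] : ∀ p i → p * i + p ≡ p * suc i
    p[i+1] = solve-∀
    regroup-l : ∀ p n l j s → l + j ≡ s → p * n + l + j ≡ p * n + s
    regroup-l p n l j s e = trans (+-assoc (p * n) l j) (cong (p * n +_) e)
    p[n+i] : ∀ p n i → p * n + p * i ≡ p * (n + i)
    p[n+i] = solve-∀
    p[i+1]+l : ∀ p i l → p * i + l + p ≡ p * suc i + l
    p[i+1]+l = solve-∀

  module _ (x y : ℕ → ℕ) (def : DefIII m p x y) where

    earlierB : ∀ {N} → (∀ i → i < N → FloorA i (x i)) → ∀ i → i < N → FloorB i (y i)
    earlierB earlier i i<N = companion-floor (companionIII x y def i) (earlier i i<N)

    class₀ : ∀ n → (∀ i → i < p * n → FloorA i (x i)) → ∀ {a} → FloorA (p * n) a → x (p * n) ≡ a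
    class₀ n earlier {a} fa = mex-unique (proj₁ (proj₁ def n)) (a∉ , below∈)
      where
      a∉ : ¬ MexSet0 p x y n a
      a∉ (i , i<n , inj₁ a≡x) = a-repeats (subst (FloorA (p * i)) (sym a≡x) (earlier (p * i) (*-monoʳ-< p i<n))) fa
                                  (subst (_≤ p * n) (sym (p[i+1] p i)) (*-monoʳ-≤ p i<n))
      a∉ (i , i<n , inj₂ a≡y) = b-no-clash (subst (FloorB (p * i)) (sym a≡y) (earlierB earlier (p * i) (*-monoʳ-< p i<n))) fa
                                  (*-monoʳ-< p i<n) (p[n+i] p n i)
      below∈ : ∀ w → w < a → MexSet0 p x y n w
      below∈ w w<a with covering fa w<a
      ... | inj₁ (i , q , e , fiw) with a-index₀ e
      ...   | i' , i'<n , refl = i' , i'<n , inj₁ (FloorA-unique fiw (earlier _ (a-index-< e)))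
      below∈ w w<a | inj₂ (i , r , i<pn , e , giw) with b-index₀ i<pn e
      ...   | i' , i'<n , refl = i' , i'<n , inj₂ (FloorB-unique giw (earlierB earlier _ i<pn))

    classₗ : ∀ n l → 0 < l → l < p → (∀ i → i < p * n + l → FloorA i (x i)) →
             ∀ {a} → FloorA (p * n + l) a → x (p * n + l) ≡ a
    classₗ n l 0<l l<p earlier {a} fa = mex-unique (proj₁ (proj₂ def n l 0<l l<p)) (a∉ , below∈)
      where
      a∉ : ¬ MexSetL p x y l n a
      a∉ (i , i<n , inj₁ a≡x) = a-repeats (subst (FloorA (p * i + l)) (sym a≡x) (earlier (p * i + l) (+-monoˡ-< l (*-monoʳ-< p i<n)))) fa
                                  (subst (_≤ p * n + l) (sym (p[i+1]+l p i l)) (+-monoˡ-≤ l (*-monoʳ-≤ p i<n)))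
      a∉ (i , i<n , inj₂ a≡y) = b-no-clash (subst (FloorB j) (sym a≡y) (earlierB earlier j j<N)) fa j<N
                                  (trans (regroup-l p n l j _ l+j≡) (p[n+i] p n (suc i)))
        where
        j = p * suc i ∸ l
        l+j≡ : l + j ≡ p * suc i
        l+j≡ = m+[n∸m]≡n (≤-trans (<⇒≤ l<p) (m≤m*n p (suc i)))
        j<N : j < p * n + l
        j<N = ≤-<-trans (≤-trans (m≤n+m j l) (subst (_≤ p * n) (sym l+j≡) (*-monoʳ-≤ p i<n))) (m<m+n (p * n) 0<l)
      below∈ : ∀ w → w < a → MexSetL p x y l n w
      below∈ w w<a with covering fa w<a
      ... | inj₁ (i , q , e , fiw) with a-indexₗ l<p e
      ...   | i' , i'<n , refl = i' , i'<n , inj₁ (FloorA-unique fiw (earlier _ (a-index-< e)))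
      below∈ w w<a | inj₂ (i , r , i<N , e , giw) with b-indexₗ 0<l l<p i<N e
      ...   | t , t≤n , l+i≡ with m≤n⇒m<n∨m≡n t≤n
      ...     | inj₁ t<n = t , t<n , inj₂ (subst (λ z → w ≡ y z) i≡ (FloorB-unique giw (earlierB earlier i i<N)))
        where i≡ : i ≡ p * suc t ∸ l
              i≡ = sym (trans (cong (_∸ l) (sym l+i≡)) (m+n∸m≡n l i))
      ...     | inj₂ refl = ⊥-elim (b-beyond giw fa w<a (trans (+-comm i l) l+i≡) refl l<p)

  floorsIII : ∀ x y → DefIII m p x y → ∀ N → FloorA N (x N)
  floorsIII x y def = floor-induction x step
    where
    step : ∀ N → (∀ i → i < N → FloorA i (x i)) → ∀ {a} → FloorA N a → x N ≡ a
    step N earlier fa with residue-split N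
    ... | inj₁ (n , refl) = class₀ x y def n earlier fa
    ... | inj₂ (n , l , 0<l , l<p , refl) = classₗ x y def n l 0<l l<p earlier fa

module Counting where
  open import Data.Nat
  open import Data.Nat.Properties
  open import Data.Bool using (Bool; true; false; if_then_else_; T; _∨_)
  open import Data.Unit using (tt)
  open import Data.Empty using (⊥-elim)
  open import Relation.Binary.PropositionalEquality
  open import Relation.Nullary using (¬_; yes; no)

  ind : Bool → ℕ
  ind b = if b then 1 else 0

  cnt : (ℕ → Bool) → ℕ → ℕ
  cnt f zero    = 0
  cnt f (suc n) = cnt f n + ind (f n)

  cnt-sum : ∀ (f g h : ℕ → Bool) n → (∀ j → j < n → ind (f j) ≡ ind (g j) + ind (h j)) →
            cnt f n ≡ cnt g n + cnt h n
  cnt-sum f g h zero    pointwise = refl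
  cnt-sum f g h (suc n) pointwise = begin
    cnt f n + ind (f n)                          ≡⟨ cong₂ _+_ (cnt-sum f g h n (λ j j<n → pointwise j (m<n⇒m<1+n j<n))) (pointwise n ≤-refl) ⟩
    (cnt g n + cnt h n) + (ind (g n) + ind (h n)) ≡⟨ +-assoc (cnt g n) (cnt h n) _ ⟩
    cnt g n + (cnt h n + (ind (g n) + ind (h n))) ≡⟨ cong (cnt g n +_) (x+[y+z]≡y+[x+z] (cnt h n) (ind (g n)) (ind (h n))) ⟩
    cnt g n + (ind (g n) + (cnt h n + ind (h n))) ≡⟨ sym (+-assoc (cnt g n) _ _) ⟩
    (cnt g n + ind (g n)) + (cnt h n + ind (h n)) ∎
    where open ≡-Reasoning
          x+[y+z]≡y+[x+z] : ∀ x y z → x + (y + z) ≡ y + (x + z)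
          x+[y+z]≡y+[x+z] x y z = trans (sym (+-assoc x y z)) (trans (cong (_+ z) (+-comm x y)) (+-assoc y x z))

  <ᵇ-suc : ∀ X v → ind (X <ᵇ suc v) ≡ ind (X <ᵇ v) + ind (X ≡ᵇ v)
  <ᵇ-suc zero    zero    = refl
  <ᵇ-suc zero    (suc v) = refl
  <ᵇ-suc (suc X) zero    = refl
  <ᵇ-suc (suc X) (suc v) = <ᵇ-suc X v

  <ᵇ-cong : ∀ {a b c d} → (a < b → c < d) → (b ≤ a → d ≤ c) → (a <ᵇ b) ≡ (c <ᵇ d)
  <ᵇ-cong {a} {b} {c} {d} to from with a <? b
  ... | yes a<b = trans (T-true (<⇒<ᵇ a<b)) (sym (T-true (<⇒<ᵇ (to a<b))))
    where T-true : ∀ {x} → T x → x ≡ true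
          T-true {true} _ = refl
  ... | no a≮b = trans (T-false (λ t → a≮b (<ᵇ⇒< a b t))) (sym (T-false (λ t → <⇒≱ (<ᵇ⇒< c d t) (from (≮⇒≥ a≮b)))))
    where T-false : ∀ {x} → ¬ T x → x ≡ false
          T-false {false} _ = refl
          T-false {true} ¬t = ⊥-elim (¬t tt)

  ind-∨-distinct : ∀ {X Y} v → X ≢ Y → ind ((X ≡ᵇ v) ∨ (Y ≡ᵇ v)) ≡ ind (X ≡ᵇ v) + ind (Y ≡ᵇ v)
  ind-∨-distinct {X} {Y} v X≢Y with X ≡ᵇ v in eX | Y ≡ᵇ v in eY
  ... | false | _     = refl
  ... | true  | false = refl
  ... | true  | true  = ⊥-elim (X≢Y (trans (≡ᵇ⇒≡ X v (subst T (sym eX) tt)) (sym (≡ᵇ⇒≡ Y v (subst T (sym eY) tt)))))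

  ind-∨-same : ∀ b → ind (b ∨ b) + ind b ≡ ind b + ind b
  ind-∨-same false = refl
  ind-∨-same true  = refl

  cnt-prefix : ∀ (f : ℕ → Bool) L n → (∀ j → j < n → f j ≡ (j <ᵇ L)) → cnt f n ≡ n ⊓ L
  cnt-prefix f L zero    prefix = refl
  cnt-prefix f L (suc n) prefix =
    trans (cong₂ _+_ (cnt-prefix f L n (λ j j<n → prefix j (m<n⇒m<1+n j<n))) (cong ind (prefix n ≤-refl))) (⊓-step n L)
    where ⊓-step : ∀ n L → n ⊓ L + ind (n <ᵇ L) ≡ suc n ⊓ L
          ⊓-step zero    zero    = refl
          ⊓-step (suc n) zero    = refl
          ⊓-step zero    (suc L) = refl
          ⊓-step (suc n) (suc L) = cong suc (⊓-step n L)

-- With all earlier terms equal to the floors, the number of j < n with a_j < v is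
-- n ⊓ thrA v (and likewise for b), so ξ_n^w is a difference of thresholds;
-- complementarity makes it exactly p for w < a_n and less than p at w = a_n.
module DefinitionI (m p : Data.Nat.ℕ) (m≥1 : 1 Data.Nat.≤ m) (p≥1 : 1 Data.Nat.≤ p) where
  open import Data.Nat
  open import Data.Nat.Properties
  open import Data.Nat.Tactic.RingSolver using (solve-∀)
  open import Relation.Binary.PropositionalEquality
  open import Data.Product using (_,_; proj₁; proj₂)
  open import Relation.Nullary using (yes; no)
  open import Defs using (DefI; count)
  open Counting
  open Floors m p m≥1 p≥1
  open FloorInduction m p m≥1 p≥1
  open MexUniqueness

  -- thrA w + thrB w = p w + 1, counting the double value a_0 = b_0 = 0 once.
  threshold-sum : ∀ w → thrA w + thrB w + ind (0 ≡ᵇ w) ≡ suc (p * w)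
  threshold-sum zero    rewrite thrA-0 | thrB-0 | *-zeroʳ p = refl
  threshold-sum (suc w) = trans (+-identityʳ _) (complementarity w)

  ⊓-growth : ∀ n A B → A ≤ B → n ⊓ B + A ≤ B + n ⊓ A
  ⊓-growth n A B A≤B with n ≤? A
  ... | yes n≤A rewrite m≤n⇒m⊓n≡m n≤A | m≤n⇒m⊓n≡m (≤-trans n≤A A≤B) = subst (n + A ≤_) (+-comm n B) (+-monoʳ-≤ n A≤B)
  ... | no n≰A rewrite m≥n⇒m⊓n≡n (<⇒≤ (≰⇒> n≰A)) = +-monoˡ-≤ A (m⊓n≤n n B)

  module Multiplicities (x y : ℕ → ℕ) (y≡ : ∀ j → y j ≡ x j + m * j) where

    below hits : (ℕ → ℕ) → ℕ → ℕ → ℕ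
    below f n v = cnt (λ j → f j <ᵇ v) n
    hits  f n v = cnt (λ j → f j ≡ᵇ v) n

    below-suc : ∀ f n v → below f n (suc v) ≡ below f n v + hits f n v
    below-suc f n v = cnt-sum _ _ _ n (λ j _ → <ᵇ-suc (f j) v)

    -- x_0 = y_0 is seen once by ξ but twice by hits.
    doubled : ℕ → ℕ → ℕ
    doubled zero    v = 0
    doubled (suc n) v = ind (x 0 ≡ᵇ v)

    private
      regroup : ∀ c i o hx ix hy iy → c + o ≡ hx + hy → i ≡ ix + iy → c + i + o ≡ (hx + ix) + (hy + iy)
      regroup c i o hx ix hy iy e₁ e₂ rewrite e₂ = trans (shuffle c ix iy o) (trans (cong (λ z → z + ix + iy) e₁) (shuffle' hx hy ix iy))
        where shuffle : ∀ c ix iy o → c + (ix + iy) + o ≡ c + o + ix + iy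
              shuffle = solve-∀
              shuffle' : ∀ hx hy ix iy → hx + hy + ix + iy ≡ (hx + ix) + (hy + iy)
              shuffle' = solve-∀

    x≢y : ∀ j → x (suc j) ≢ y (suc j)
    x≢y j e = a≢a+m[j+1] (trans e (y≡ (suc j)))
      where a≢a+m[j+1] : ∀ {a} → a ≢ a + m * suc j
            a≢a+m[j+1] {a} = <⇒≢ (m<m+n a (*-mono-≤ m≥1 (s≤s z≤n)))

    count-split : ∀ n v → count x y n v + doubled n v ≡ hits x n v + hits y n v
    count-split zero          v = refl
    count-split (suc zero)    v rewrite y≡ 0 | *-zeroʳ m | +-identityʳ (x 0) = ind-∨-same (x 0 ≡ᵇ v)
    count-split (suc (suc n)) v =
      regroup (count x y (suc n) v) _ (ind (x 0 ≡ᵇ v)) (hits x (suc n) v) (ind (x (suc n) ≡ᵇ v)) (hits y (suc n) v) (ind (y (suc n) ≡ᵇ v))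
              (count-split (suc n) v) (ind-∨-distinct v (x≢y n))

    balance : ∀ n v → count x y n v + doubled n v + below x n v + below y n v ≡ below x n (suc v) + below y n (suc v)
    balance n v = begin
      count x y n v + doubled n v + below x n v + below y n v  ≡⟨ cong (λ z → z + below x n v + below y n v) (count-split n v) ⟩
      hits x n v + hits y n v + below x n v + below y n v      ≡⟨ shuffle (hits x n v) (hits y n v) (below x n v) (below y n v) ⟩
      (below x n v + hits x n v) + (below y n v + hits y n v)  ≡⟨ sym (cong₂ _+_ (below-suc x n v) (below-suc y n v)) ⟩
      below x n (suc v) + below y n (suc v)                    ∎
      where open ≡-Reasoning
            shuffle : ∀ hx hy bx by → hx + hy + bx + by ≡ (bx + hx) + (by + hy)
            shuffle = solve-∀

    module Stage (n : ℕ) (earlier : ∀ i → i < n → FloorA i (x i)) where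

      below-x : ∀ v → below x n v ≡ n ⊓ thrA v
      below-x v = cnt-prefix _ (thrA v) n λ j j<n →
        <ᵇ-cong (λ xj<v → ≰⇒> λ thr≤j → <⇒≱ xj<v (thr≤-FloorA (earlier j j<n) thr≤j)) (FloorA-thr≤ (earlier j j<n))

      below-y : ∀ v → below y n v ≡ n ⊓ thrB v
      below-y v = cnt-prefix _ (thrB v) n λ j j<n →
        <ᵇ-cong (λ yj<v → ≰⇒> λ thr≤j → <⇒≱ yj<v (thr≤-FloorB (fb j j<n) thr≤j)) (FloorB-thr≤ (fb j j<n))
        where fb : ∀ j → j < n → FloorB j (y j)
              fb j j<n = companion-floor (y≡ j) (earlier j j<n)

      doubled-zero : 0 < n → ∀ v → doubled n v ≡ ind (0 ≡ᵇ v)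
      doubled-zero (s≤s z≤n) v = cong (λ z → ind (z ≡ᵇ v)) (FloorA-unique (earlier 0 (s≤s z≤n)) a₀)
        where a₀ : FloorA 0 0
              a₀ = thr-FloorA (≤-reflexive thrA-0) (thrA-pos 0)

      threshold-balance : 0 < n → ∀ v → count x y n v + ind (0 ≡ᵇ v) + n ⊓ thrA v + n ⊓ thrB v
                                        ≡ n ⊓ thrA (suc v) + n ⊓ thrB (suc v)
      threshold-balance 0<n v = begin
        count x y n v + ind (0 ≡ᵇ v) + n ⊓ thrA v + n ⊓ thrB v
          ≡⟨ cong₃ (λ d bx by → count x y n v + d + bx + by) (sym (doubled-zero 0<n v)) (sym (below-x v)) (sym (below-y v)) ⟩
        count x y n v + doubled n v + below x n v + below y n v
          ≡⟨ balance n v ⟩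
        below x n (suc v) + below y n (suc v)
          ≡⟨ cong₂ _+_ (below-x (suc v)) (below-y (suc v)) ⟩
        n ⊓ thrA (suc v) + n ⊓ thrB (suc v) ∎
        where open ≡-Reasoning
              cong₃ : ∀ (f : ℕ → ℕ → ℕ → ℕ) {a a' b b' c c'} → a ≡ a' → b ≡ b' → c ≡ c' → f a b c ≡ f a' b' c'
              cong₃ f refl refl refl = refl

      private
        regroup₁ : ∀ c A B o → c + (A + B + o) ≡ c + o + A + B
        regroup₁ = solve-∀
        regroup₂ : ∀ c A B o M → c + (A + B + o) + M ≡ c + o + A + M + B
        regroup₂ = solve-∀
        p[w+1]+1 : ∀ p w → suc (p * suc w) ≡ p + suc (p * w)
        p[w+1]+1 = solve-∀

      count-below-floor : ∀ {a w} → FloorA n a → w < a → count x y n w ≡ p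
      count-below-floor {a} {w} fa w<a = +-cancelʳ-≡ (suc (p * w)) _ p (begin
        c + suc (p * w)                       ≡⟨ cong (c +_) (sym (threshold-sum w)) ⟩
        c + (thrA w + thrB w + o)             ≡⟨ regroup₁ c (thrA w) (thrB w) o ⟩
        c + o + thrA w + thrB w               ≡⟨ cong₂ (λ A B → c + o + A + B) (sym (m≥n⇒m⊓n≡n A≤n)) (sym (m≥n⇒m⊓n≡n B≤n)) ⟩
        c + o + n ⊓ thrA w + n ⊓ thrB w       ≡⟨ threshold-balance (<-≤-trans (thrA-pos w) A'≤n) w ⟩
        n ⊓ thrA (suc w) + n ⊓ thrB (suc w)   ≡⟨ cong₂ _+_ (m≥n⇒m⊓n≡n A'≤n) (m≥n⇒m⊓n≡n B'≤n) ⟩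
        thrA (suc w) + thrB (suc w)           ≡⟨ complementarity w ⟩
        suc (p * suc w)                       ≡⟨ p[w+1]+1 p w ⟩
        p + suc (p * w)                       ∎)
        where
        open ≡-Reasoning
        c = count x y n w
        o = ind (0 ≡ᵇ w)
        A'≤n = FloorA-thr≤ fa w<a
        B'≤n = ≤-trans (thrB≤thrA (suc w)) A'≤n
        A≤n  = ≤-trans (thrA-mono (n≤1+n w)) A'≤n
        B≤n  = ≤-trans (thrB≤thrA w) A≤n

      count-at-floor : ∀ {a} → FloorA n a → count x y n a < p
      count-at-floor {a} fa with 0 <? n
      ... | no n≯0 = subst (λ z → count x y z a < p) (sym (n≤0⇒n≡0 (≮⇒≥ n≯0))) p≥1
      ... | yes n>0 = +-cancelʳ-< (suc (p * a)) c p (begin-strict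
        c + suc (p * a)               ≤⟨ +-cancelʳ-≤ M _ _ (begin
           c + suc (p * a) + M                 ≡⟨ cong (λ z → c + z + M) (sym (threshold-sum a)) ⟩
           c + (thrA a + thrB a + o) + M       ≡⟨ regroup₂ c (thrA a) (thrB a) o M ⟩
           c + o + thrA a + M + thrB a         ≡⟨ cong (λ z → c + o + z + M + thrB a) (sym (m≥n⇒m⊓n≡n (FloorA-lower fa))) ⟩
           c + o + n ⊓ thrA a + M + thrB a     ≡⟨ cong (_+ thrB a) (threshold-balance n>0 a) ⟩
           n ⊓ thrA (suc a) + n ⊓ B' + thrB a  ≡⟨ cong (λ z → z + n ⊓ B' + thrB a) (m≤n⇒m⊓n≡m (<⇒≤ (FloorA-upper fa))) ⟩
           n + n ⊓ B' + thrB a                 ≡⟨ +-assoc n (n ⊓ B') (thrB a) ⟩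
           n + (n ⊓ B' + thrB a)               ≤⟨ +-monoʳ-≤ n (⊓-growth n (thrB a) B' (thrB-mono (n≤1+n a))) ⟩
           n + (B' + M)                        ≡⟨ sym (+-assoc n B' M) ⟩
           n + B' + M                          ∎) ⟩
        n + B'                        <⟨ +-monoˡ-< B' (FloorA-upper fa) ⟩
        thrA (suc a) + B'             ≡⟨ complementarity a ⟩
        suc (p * suc a)               ≡⟨ p[w+1]+1 p a ⟩
        p + suc (p * a)               ∎)
        where
        open ≤-Reasoning
        c = count x y n a
        o = ind (0 ≡ᵇ a)
        M = n ⊓ thrB a
        B' = thrB (suc a)

  floorsI : ∀ x y → DefI m p x y → ∀ n → FloorA n (x n)
  floorsI x y def = floor-induction x step
    where
    open Multiplicities x y (λ j → proj₂ (def j))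
    step : ∀ n → (∀ i → i < n → FloorA i (x i)) → ∀ {a} → FloorA n a → x n ≡ a
    step n earlier fa = mexP-unique (proj₁ (def n)) (count-at-floor fa , λ w w<a → ≤-reflexive (sym (count-below-floor fa w<a)))
      where open Stage n earlier

module Conclusion (m p : Data.Nat.ℕ) (m≥1 : 1 Data.Nat.≤ m) (p≥1 : 1 Data.Nat.≤ p) where
  open import Data.Nat using (_+_; _*_)
  open import Relation.Binary.PropositionalEquality using (_≡_; subst; sym)
  open import Data.Product using (_×_; _,_; proj₁; proj₂)
  open import Defs using (IsA; IsB)
  open FloorForms m p m≥1 p≥1 using (isA-intro; isB-intro)
  open Floors m p m≥1 p≥1 using (FloorA; FloorA⇒FloorB)

  floor-values : ∀ {n a b} → FloorA n a → b ≡ a + m * n → IsA m p n a × IsB m p n b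
  floor-values {n} fa b≡ = isA-intro (proj₁ fa) (proj₂ fa) , subst (IsB m p n) (sym b≡) (isB-intro (proj₁ fb) (proj₂ fb))
    where fb = FloorA⇒FloorB fa

open import Defs
open import Data.Nat using (ℕ; _≤_)
open import Data.Product using (_×_; _,_; proj₂)

proposition5p3 : (m p : ℕ) → 1 ≤ m → 1 ≤ p →
    ((x y : ℕ → ℕ) → DefI m p x y → ∀ n → IsA m p n (x n) × IsB m p n (y n)) ×
    ((x y : ℕ → ℕ) → DefII m p x y → ∀ n → IsA m p n (x n) × IsB m p n (y n)) ×
    ((x y : ℕ → ℕ) → DefIII m p x y → ∀ n → IsA m p n (x n) × IsB m p n (y n))
proposition5p3 m p m≥1 p≥1 =
    (λ x y def n → floor-values (floorsI x y def n) (proj₂ (def n)))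
  , (λ x y def n → floor-values (floorsII x y def n) (proj₂ (def n)))
  , (λ x y def n → floor-values (floorsIII x y def n) (companionIII x y def n))
  where
  open Conclusion m p m≥1 p≥1
  open DefinitionI m p m≥1 p≥1 using (floorsI)
  open DefinitionII m p m≥1 p≥1 using (floorsII)
  open DefinitionIII m p m≥1 p≥1 using (floorsIII; companionIII)
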